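{- Let $d\ge 0$ be an integer and let $\lambda_0,\dots,\lambda_d$ be integers with $\sum_{i=0}^{d}|\lambda_i|>0$; write $\underline{\lambda}=(\lambda_0,\dots,\lambda_d)$. Then for every sufficiently large positive integer $M$ there exists a set $C_M\subset[0,M(d+1)-1]$ of nonnegative integers such that \[ |R_{C_M}(n)-R_{C_M}(n-1)|\le 12\sqrt{M(d+1)\log\big(M(d+1)\big)} \] for every nonnegative integer $n$, and \[ B(C_M,\underline{\lambda},M(d+1)-1)\ge \frac{M}{2^{d+2}}. \]
   Context: $\log$ is the natural logarithm. For a set $C$ of nonnegative integers and an integer $n$, $R_C(n)$ denotes the number of ordered pairs $(c,c')\in C\times C$ with $c+c'=n$ (so $R_C(n)=0$ for $n<0$). $\chi_C$ is the characteristic function of $C$ on the integers ($\chi_C(m)=0$ for $m<0$). For $\underline{\lambda}=(\lambda_0,\dots,\lambda_d)$ define $B(C,\underline{\lambda},n)=\#\{m\in\mathbb{Z}_{\ge 0}: m\le n,\ \sum_{i=0}^{d}\lambda_i\chi_C(m-i)\neq 0\}$. -}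

module Defs where

open import Data.Nat using (ℕ; zero; suc; _+_; _*_; _∸_; _^_; _≤_; _≤ᵇ_; _!)

open import Data.Bool using (Bool; true; false; if_then_else_; _∧_; not)
open import Data.Integer as ℤ using (ℤ; ∣_∣; _⊖_)
open import Data.Fin using (Fin; toℕ)
import Data.Fin as Fin
open import Relation.Nullary.Decidable using (⌊_⌋)

countUpTo : (ℕ → Bool) → ℕ → ℕ
countUpTo p zero = if p 0 then 1 else 0
countUpTo p (suc n) = countUpTo p n + (if p (suc n) then 1 else 0)

R : (ℕ → Bool) → ℕ → ℕ
R C n = countUpTo (λ c → C c ∧ C (n ∸ c)) n

-- R_C(n - 1), with R_C(-1) = 0.
Rprev : (ℕ → Bool) → ℕ → ℕ
Rprev C zero = 0
Rprev C (suc n) = R C n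

-- χ_C(m - i) as an integer, with χ_C(negative) = 0.
chiShift : (ℕ → Bool) → ℕ → ℕ → ℤ
chiShift C m i = if i ≤ᵇ m then (if C (m ∸ i) then ℤ.+ 1 else ℤ.+ 0) else ℤ.+ 0

sumℤ : ∀ {k} → (Fin k → ℤ) → ℤ
sumℤ {zero} f = ℤ.+ 0
sumℤ {suc k} f = f Fin.zero ℤ.+ sumℤ (λ i → f (Fin.suc i))

sumℕ : ∀ {k} → (Fin k → ℕ) → ℕ
sumℕ {zero} f = 0
sumℕ {suc k} f = f Fin.zero + sumℕ (λ i → f (Fin.suc i))

B : ∀ {d} → (ℕ → Bool) → (Fin (suc d) → ℤ) → ℕ → ℕ
B C lam n =
  countUpTo (λ m → not ⌊ sumℤ (λ i → lam i ℤ.* chiShift C m (toℕ i)) ℤ.≟ ℤ.+ 0 ⌋) n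

-- expPartialScaled a k = k! · Σ_{j=0}^{k} a^j / j!   (a natural number)
expPartialScaled : ℕ → ℕ → ℕ
expPartialScaled a zero = 1
expPartialScaled a (suc k) = suc k * expPartialScaled a k + a ^ suc k

-- ExpLe a Y  ⇔  e^a ≤ Y  (real exponential), since the partial sums of the
-- exponential series increase to e^a:  e^a ≤ Y ⇔ ∀ k, Σ_{j≤k} a^j/j! ≤ Y.
ExpLe : ℕ → ℕ → Set
ExpLe a Y = ∀ k → expPartialScaled a k ≤ Y * k !

-- DiffBound D N  ⇔  |D| ≤ 12 √(N log N)   (for N ≥ 1, D ∈ ℤ)
-- Indeed |D| ≤ 12√(N log N) ⇔ D² ≤ 144 N log N ⇔ e^{D²} ≤ N^{144 N}.
DiffBound : ℤ → ℕ → Set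
DiffBound D N = ExpLe (∣ D ∣ * ∣ D ∣) (N ^ (144 * N))

{-# OPTIONS --safe #-}
module Submission where

-- Cut [0, M(d+1)) into M blocks of length d + 1 and give every block b a sign ε_b: a positive
-- block contributes its last point to C, a negative one all its other points. Then
-- 2χ_C = 𝟙_[0,M(d+1)) + f with f = Σ_b ε_b h(· − b(d+1)) and h = (−1, …, −1, 1), so that
-- 4(R_C(n) − R_C(n−1)) = (Δ(2χ_C) ⋆ 2χ_C)(n) equals Δf ⋆ f up to three boundary terms of size 1.
-- Since Δh ⋆ h = −h + 2h(· − d) − h(· − d − 1), Δf ⋆ f is a combination of translates of
-- K = Σ_j a_j h(· − j(d+1)), where a_j = Σ_{i+i′=j} ε_i ε_i′ are the autocorrelations of ε.
-- A Chernoff bound and a union bound over j give signs with all |a_j| = O(√(M log M)), and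
-- after flipping all signs if necessary at least half of them are positive. If λ_j₀ is the
-- first nonzero coefficient, every positive block b yields the point b(d+1) + d + j₀ counted by B.

open import Data.Nat using (ℕ)

module Sequences where

  open import Data.Nat as ℕ using (ℕ; zero; suc; _∸_; z≤n)
  import Data.Nat.Properties as ℕ
  open import Data.Integer using (ℤ; _+_; _*_; 0ℤ; 1ℤ; -1ℤ; ∣_∣)
  open import Data.Integer.Properties
  open import Data.Integer.Tactic.RingSolver using (solve-∀)
  open import Relation.Binary.Bundles using (Setoid)
  open import Relation.Binary.PropositionalEquality
  import Relation.Binary.Reasoning.Setoid as SetoidReasoning

  -- A sequence on ℕ stands for a function on ℤ vanishing on the negatives, so that
  -- shift k a = a(· − k) and ⋆ is the convolution of such functions.
  Seq : Set
  Seq = ℕ → ℤ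

  module ≗-Reasoning = SetoidReasoning (ℕ →-setoid ℤ)
  open Setoid (ℕ →-setoid ℤ) public using () renaming (sym to ≗-sym; trans to ≗-trans)

  Σ≤ : Seq → ℕ → ℤ
  Σ≤ f zero    = f zero
  Σ≤ f (suc n) = Σ≤ f n + f (suc n)

  Σ≤-cong : ∀ {f g} n → (∀ i → i ℕ.≤ n → f i ≡ g i) → Σ≤ f n ≡ Σ≤ g n
  Σ≤-cong zero    f≡g = f≡g 0 z≤n
  Σ≤-cong (suc n) f≡g = cong₂ _+_ (Σ≤-cong n (λ i i≤n → f≡g i (ℕ.m≤n⇒m≤1+n i≤n))) (f≡g (suc n) ℕ.≤-refl)

  Σ≤-zero : ∀ f n → (∀ i → i ℕ.≤ n → f i ≡ 0ℤ) → Σ≤ f n ≡ 0ℤ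
  Σ≤-zero f zero    f≡0 = f≡0 0 z≤n
  Σ≤-zero f (suc n) f≡0
    rewrite Σ≤-zero f n (λ i i≤n → f≡0 i (ℕ.m≤n⇒m≤1+n i≤n)) | f≡0 (suc n) ℕ.≤-refl = refl

  Σ≤-distrib-+ : ∀ f g n → Σ≤ (λ i → f i + g i) n ≡ Σ≤ f n + Σ≤ g n
  Σ≤-distrib-+ f g zero    = refl
  Σ≤-distrib-+ f g (suc n) rewrite Σ≤-distrib-+ f g n = swap (Σ≤ f n) (Σ≤ g n) (f (suc n)) (g (suc n))
    where
    swap : ∀ a b c d → a + b + (c + d) ≡ a + c + (b + d)
    swap = solve-∀

  Σ≤-distribˡ-* : ∀ k f n → Σ≤ (λ i → k * f i) n ≡ k * Σ≤ f n
  Σ≤-distribˡ-* k f zero    = refl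
  Σ≤-distribˡ-* k f (suc n) rewrite Σ≤-distribˡ-* k f n = sym (*-distribˡ-+ k (Σ≤ f n) (f (suc n)))

  Σ≤-unconsˡ : ∀ f n → Σ≤ f (suc n) ≡ f 0 + Σ≤ (λ i → f (suc i)) n
  Σ≤-unconsˡ f zero    = refl
  Σ≤-unconsˡ f (suc n) rewrite Σ≤-unconsˡ f n = +-assoc (f 0) _ _

  infixl 6 _⊕_
  infixr 7 _⊙_
  infixl 7 _⋆_

  _⊕_ : Seq → Seq → Seq
  (a ⊕ b) n = a n + b n

  _⊙_ : ℤ → Seq → Seq
  (k ⊙ a) n = k * a n

  0ₛ : Seq
  0ₛ _ = 0ℤ

  _⋆_ : Seq → Seq → Seq
  (a ⋆ b) n = Σ≤ (λ i → a i * b (n ∸ i)) n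

  δ : Seq
  δ zero    = 1ℤ
  δ (suc n) = 0ℤ

  shift₁ : Seq → Seq
  shift₁ a zero    = 0ℤ
  shift₁ a (suc n) = a n

  shift : ℕ → Seq → Seq
  shift zero    a = a
  shift (suc k) a = shift₁ (shift k a)

  Δ⟨_⟩_ : ℕ → Seq → Seq
  Δ⟨ k ⟩ a = a ⊕ -1ℤ ⊙ shift k a

  Δ : Seq → Seq
  Δ = Δ⟨ 1 ⟩_

  ⊕-cong : ∀ {a a′ b b′} → a ≗ a′ → b ≗ b′ → a ⊕ b ≗ a′ ⊕ b′
  ⊕-cong a≗a′ b≗b′ n = cong₂ _+_ (a≗a′ n) (b≗b′ n)

  ⊙-cong : ∀ k {a a′} → a ≗ a′ → k ⊙ a ≗ k ⊙ a′
  ⊙-cong k a≗a′ n = cong (k *_) (a≗a′ n)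

  ⋆-cong : ∀ {a a′ b b′} → a ≗ a′ → b ≗ b′ → a ⋆ b ≗ a′ ⋆ b′
  ⋆-cong a≗a′ b≗b′ n = Σ≤-cong n (λ i _ → cong₂ _*_ (a≗a′ i) (b≗b′ (n ∸ i)))

  shift₁-cong : ∀ {a a′} → a ≗ a′ → shift₁ a ≗ shift₁ a′
  shift₁-cong a≗a′ zero    = refl
  shift₁-cong a≗a′ (suc n) = a≗a′ n

  shift-cong : ∀ k {a a′} → a ≗ a′ → shift k a ≗ shift k a′
  shift-cong zero    a≗a′ = a≗a′
  shift-cong (suc k) a≗a′ = shift₁-cong (shift-cong k a≗a′)

  Δ⟨⟩-cong : ∀ k {a a′} → a ≗ a′ → Δ⟨ k ⟩ a ≗ Δ⟨ k ⟩ a′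
  Δ⟨⟩-cong k a≗a′ = ⊕-cong a≗a′ (⊙-cong -1ℤ (shift-cong k a≗a′))

  shift₁-⊕ : ∀ a b → shift₁ (a ⊕ b) ≗ shift₁ a ⊕ shift₁ b
  shift₁-⊕ a b zero    = refl
  shift₁-⊕ a b (suc n) = refl

  shift₁-⊙ : ∀ k a → shift₁ (k ⊙ a) ≗ k ⊙ shift₁ a
  shift₁-⊙ k a zero    = sym (*-zeroʳ k)
  shift₁-⊙ k a (suc n) = refl

  shift-⊕ : ∀ k a b → shift k (a ⊕ b) ≗ shift k a ⊕ shift k b
  shift-⊕ zero    a b n = refl
  shift-⊕ (suc k) a b n = trans (shift₁-cong (shift-⊕ k a b) n) (shift₁-⊕ (shift k a) (shift k b) n)

  shift-⊙ : ∀ k c a → shift k (c ⊙ a) ≗ c ⊙ shift k a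
  shift-⊙ zero    c a n = refl
  shift-⊙ (suc k) c a n = trans (shift₁-cong (shift-⊙ k c a) n) (shift₁-⊙ c (shift k a) n)

  shift-0ₛ : ∀ k → shift k 0ₛ ≗ 0ₛ
  shift-0ₛ zero    n       = refl
  shift-0ₛ (suc k) zero    = refl
  shift-0ₛ (suc k) (suc n) = shift-0ₛ k n

  shift-comm : ∀ k m a → shift k (shift m a) ≗ shift m (shift k a)
  shift-comm k zero    a n = refl
  shift-comm k (suc m) a n = trans (shift-shift₁ k (shift m a) n) (shift₁-cong (shift-comm k m a) n)
    where
    shift-shift₁ : ∀ k a → shift k (shift₁ a) ≗ shift₁ (shift k a)
    shift-shift₁ zero    a n = refl
    shift-shift₁ (suc k) a n = shift₁-cong (shift-shift₁ k a) n

  shift-< : ∀ k a n → n ℕ.< k → shift k a n ≡ 0ℤ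
  shift-< (suc k) a zero    _           = refl
  shift-< (suc k) a (suc n) (ℕ.s≤s n<k) = shift-< k a n n<k

  shift-+ : ∀ k a n → shift k a (k ℕ.+ n) ≡ a n
  shift-+ zero    a n = refl
  shift-+ (suc k) a n = shift-+ k a n

  shift-≥ : ∀ k a n → k ℕ.≤ n → shift k a n ≡ a (n ∸ k)
  shift-≥ k a n k≤n = trans (cong (shift k a) (sym (ℕ.m+[n∸m]≡n k≤n))) (shift-+ k a (n ∸ k))

  Δ⟨⟩-⊕ : ∀ k a b → Δ⟨ k ⟩ (a ⊕ b) ≗ Δ⟨ k ⟩ a ⊕ Δ⟨ k ⟩ b
  Δ⟨⟩-⊕ k a b n =
    trans (cong (λ z → a n + b n + -1ℤ * z) (shift-⊕ k a b n)) (regroup (a n) (b n) (shift k a n) (shift k b n))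
    where
    regroup : ∀ x y z w → x + y + -1ℤ * (z + w) ≡ x + -1ℤ * z + (y + -1ℤ * w)
    regroup = solve-∀

  Δ⟨⟩-⊙ : ∀ k c a → Δ⟨ k ⟩ (c ⊙ a) ≗ c ⊙ Δ⟨ k ⟩ a
  Δ⟨⟩-⊙ k c a n = trans (cong (λ z → c * a n + -1ℤ * z) (shift-⊙ k c a n)) (factor c (a n) (shift k a n))
    where
    factor : ∀ c x y → c * x + -1ℤ * (c * y) ≡ c * (x + -1ℤ * y)
    factor = solve-∀

  ∣shift∣≤ : ∀ k a B → (∀ m → ∣ a m ∣ ℕ.≤ B) → ∀ n → ∣ shift k a n ∣ ℕ.≤ B
  ∣shift∣≤ zero    a B ∣a∣≤B n       = ∣a∣≤B n
  ∣shift∣≤ (suc k) a B ∣a∣≤B zero    = z≤n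
  ∣shift∣≤ (suc k) a B ∣a∣≤B (suc n) = ∣shift∣≤ k a B ∣a∣≤B n

  ∣i+j∣≤m+n : ∀ i j {m n} → ∣ i ∣ ℕ.≤ m → ∣ j ∣ ℕ.≤ n → ∣ i + j ∣ ℕ.≤ m ℕ.+ n
  ∣i+j∣≤m+n i j ∣i∣≤m ∣j∣≤n = ℕ.≤-trans (∣i+j∣≤∣i∣+∣j∣ i j) (ℕ.+-mono-≤ ∣i∣≤m ∣j∣≤n)

  ∣-1*i∣≡∣i∣ : ∀ i → ∣ -1ℤ * i ∣ ≡ ∣ i ∣
  ∣-1*i∣≡∣i∣ i = trans (abs-* -1ℤ i) (ℕ.+-identityʳ ∣ i ∣)

  ⋆-zeroˡ : ∀ b → 0ₛ ⋆ b ≗ 0ₛ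
  ⋆-zeroˡ b n = Σ≤-zero _ n (λ i _ → *-zeroˡ (b (n ∸ i)))

  ⋆-zeroʳ : ∀ a → a ⋆ 0ₛ ≗ 0ₛ
  ⋆-zeroʳ a n = Σ≤-zero _ n (λ i _ → *-zeroʳ (a i))

  ⋆-identityˡ : ∀ b → δ ⋆ b ≗ b
  ⋆-identityˡ b zero    = *-identityˡ (b 0)
  ⋆-identityˡ b (suc n) = trans (Σ≤-unconsˡ _ n)
    (trans (cong₂ _+_ (*-identityˡ (b (suc n))) (Σ≤-zero _ n (λ i _ → *-zeroˡ (b (n ∸ i))))) (+-identityʳ _))

  ⋆-identityʳ : ∀ a → a ⋆ δ ≗ a
  ⋆-identityʳ a zero    = *-identityʳ (a 0)
  ⋆-identityʳ a (suc n) =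
    trans (cong₂ _+_ (Σ≤-zero _ n (λ i i≤n → trans (cong (λ z → a i * δ z) (ℕ.+-∸-assoc 1 i≤n)) (*-zeroʳ (a i))))
                     (trans (cong (λ z → a (suc n) * δ z) (ℕ.n∸n≡0 n)) (*-identityʳ (a (suc n)))))
          (+-identityˡ _)

  ⋆-distribʳ-⊕ : ∀ a a′ b → (a ⊕ a′) ⋆ b ≗ a ⋆ b ⊕ a′ ⋆ b
  ⋆-distribʳ-⊕ a a′ b n = trans (Σ≤-cong n (λ i _ → *-distribʳ-+ (b (n ∸ i)) (a i) (a′ i))) (Σ≤-distrib-+ _ _ n)

  ⋆-distribˡ-⊕ : ∀ a b b′ → a ⋆ (b ⊕ b′) ≗ a ⋆ b ⊕ a ⋆ b′
  ⋆-distribˡ-⊕ a b b′ n = trans (Σ≤-cong n (λ i _ → *-distribˡ-+ (a i) (b (n ∸ i)) (b′ (n ∸ i)))) (Σ≤-distrib-+ _ _ n)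

  ⋆-⊙ˡ : ∀ k a b → (k ⊙ a) ⋆ b ≗ k ⊙ (a ⋆ b)
  ⋆-⊙ˡ k a b n = trans (Σ≤-cong n (λ i _ → *-assoc k (a i) (b (n ∸ i)))) (Σ≤-distribˡ-* k _ n)

  ⋆-⊙ʳ : ∀ k a b → a ⋆ (k ⊙ b) ≗ k ⊙ (a ⋆ b)
  ⋆-⊙ʳ k a b n = trans (Σ≤-cong n (λ i _ → x*[k*y]≡k*[x*y] k (a i) (b (n ∸ i)))) (Σ≤-distribˡ-* k _ n)
    where
    x*[k*y]≡k*[x*y] : ∀ k x y → x * (k * y) ≡ k * (x * y)
    x*[k*y]≡k*[x*y] = solve-∀

  ⋆-shift₁ˡ : ∀ a b → shift₁ a ⋆ b ≗ shift₁ (a ⋆ b)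
  ⋆-shift₁ˡ a b zero    = *-zeroˡ (b 0)
  ⋆-shift₁ˡ a b (suc n) =
    trans (Σ≤-unconsˡ _ n) (trans (cong (_+ (a ⋆ b) n) (*-zeroˡ (b (suc n)))) (+-identityˡ _))

  ⋆-shift₁ʳ : ∀ a b → a ⋆ shift₁ b ≗ shift₁ (a ⋆ b)
  ⋆-shift₁ʳ a b zero    = *-zeroʳ (a 0)
  ⋆-shift₁ʳ a b (suc n) =
    trans (cong₂ _+_ (Σ≤-cong n (λ i i≤n → cong (λ z → a i * shift₁ b z) (ℕ.+-∸-assoc 1 i≤n)))
                     (trans (cong (λ z → a (suc n) * shift₁ b z) (ℕ.n∸n≡0 n)) (*-zeroʳ (a (suc n)))))
          (+-identityʳ _)

  ⋆-shiftˡ : ∀ k a b → shift k a ⋆ b ≗ shift k (a ⋆ b)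
  ⋆-shiftˡ zero    a b n = refl
  ⋆-shiftˡ (suc k) a b n = trans (⋆-shift₁ˡ (shift k a) b n) (shift₁-cong (⋆-shiftˡ k a b) n)

  ⋆-shiftʳ : ∀ k a b → a ⋆ shift k b ≗ shift k (a ⋆ b)
  ⋆-shiftʳ zero    a b n = refl
  ⋆-shiftʳ (suc k) a b n = trans (⋆-shift₁ʳ a (shift k b) n) (shift₁-cong (⋆-shiftʳ k a b) n)

  ⋆-Δ⟨⟩ˡ : ∀ k a b → Δ⟨ k ⟩ a ⋆ b ≗ Δ⟨ k ⟩ (a ⋆ b)
  ⋆-Δ⟨⟩ˡ k a b = ≗-trans (⋆-distribʳ-⊕ a (-1ℤ ⊙ shift k a) b)
                         (⊕-cong {a = a ⋆ b} (λ _ → refl) (≗-trans (⋆-⊙ˡ -1ℤ (shift k a) b) (⊙-cong -1ℤ (⋆-shiftˡ k a b))))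

  ⋆-Δ⟨⟩ʳ : ∀ k a b → a ⋆ Δ⟨ k ⟩ b ≗ Δ⟨ k ⟩ (a ⋆ b)
  ⋆-Δ⟨⟩ʳ k a b = ≗-trans (⋆-distribˡ-⊕ a b (-1ℤ ⊙ shift k b))
                         (⊕-cong {a = a ⋆ b} (λ _ → refl) (≗-trans (⋆-⊙ʳ -1ℤ a (shift k b)) (⊙-cong -1ℤ (⋆-shiftʳ k a b))))

  δshift-⋆ : ∀ k g → shift k δ ⋆ g ≗ shift k g
  δshift-⋆ k g = ≗-trans (⋆-shiftˡ k δ g) (shift-cong k (⋆-identityˡ g))

  ⋆-δshift : ∀ k g → g ⋆ shift k δ ≗ shift k g
  ⋆-δshift k g = ≗-trans (⋆-shiftʳ k g δ) (shift-cong k (⋆-identityʳ g))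

module Tiling where

  open import Data.Nat as ℕ using (ℕ; zero; suc; _∸_; z≤n)
  import Data.Nat.Properties as ℕ
  open import Data.Integer using (ℤ; _+_; _*_; 0ℤ; 1ℤ; -1ℤ; ∣_∣)
  open import Data.Integer.Properties
  open import Data.Integer.Tactic.RingSolver using (solve-∀)
  open import Data.List using (List; []; _∷_; map; length)
  open import Relation.Nullary.Decidable using (yes; no)
  open import Relation.Binary.PropositionalEquality
  open Sequences

  infixl 6 _+ₚ_
  infixl 7 _*ₚ_ _·ₚ_

  _+ₚ_ : List ℤ → List ℤ → List ℤ
  []       +ₚ q        = q
  (a ∷ p)  +ₚ []       = a ∷ p
  (a ∷ p)  +ₚ (b ∷ q)  = (a + b) ∷ (p +ₚ q)

  _·ₚ_ : ℤ → List ℤ → List ℤ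
  k ·ₚ q = map (k *_) q

  _*ₚ_ : List ℤ → List ℤ → List ℤ
  []      *ₚ q = []
  (a ∷ p) *ₚ q = a ·ₚ q +ₚ (0ℤ ∷ p *ₚ q)

  coeff : List ℤ → Seq
  coeff []       n       = 0ℤ
  coeff (x ∷ xs) zero    = x
  coeff (x ∷ xs) (suc n) = coeff xs n

  module Tile (p : ℕ) where

    tile : Seq → List ℤ → Seq
    tile a []       = 0ₛ
    tile a (e ∷ es) = e ⊙ a ⊕ shift p (tile a es)

    tile-cong : ∀ {a a′} e → a ≗ a′ → tile a e ≗ tile a′ e
    tile-cong []       a≗a′ n = refl
    tile-cong (x ∷ xs) a≗a′   = ⊕-cong (⊙-cong x a≗a′) (shift-cong p (tile-cong xs a≗a′))

    tile-+ₚ : ∀ c x y → tile c (x +ₚ y) ≗ tile c x ⊕ tile c y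
    tile-+ₚ c []      y       n = sym (+-identityˡ _)
    tile-+ₚ c (a ∷ x) []      n = sym (+-identityʳ _)
    tile-+ₚ c (a ∷ x) (b ∷ y) n =
      trans (cong₂ _+_ (*-distribʳ-+ (c n) a b) (trans (shift-cong p (tile-+ₚ c x y) n) (shift-⊕ p _ _ n)))
            (swap (a * c n) (b * c n) (shift p (tile c x) n) (shift p (tile c y) n))
      where
      swap : ∀ u v w z → u + v + (w + z) ≡ u + w + (v + z)
      swap = solve-∀

    tile-·ₚ : ∀ k c x → tile c (k ·ₚ x) ≗ k ⊙ tile c x
    tile-·ₚ k c []      n = sym (*-zeroʳ k)
    tile-·ₚ k c (a ∷ x) n =
      trans (cong₂ _+_ (*-assoc k a (c n)) (trans (shift-cong p (tile-·ₚ k c x) n) (shift-⊙ p k _ n)))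
            (sym (*-distribˡ-+ k _ _))

    tile-0∷ : ∀ c x → tile c (0ℤ ∷ x) ≗ shift p (tile c x)
    tile-0∷ c x n = trans (cong (_+ shift p (tile c x) n) (*-zeroˡ (c n))) (+-identityˡ _)

    tile-⊕ : ∀ a b e → tile (a ⊕ b) e ≗ tile a e ⊕ tile b e
    tile-⊕ a b []       n = refl
    tile-⊕ a b (x ∷ xs) n =
      trans (cong₂ _+_ (*-distribˡ-+ x (a n) (b n)) (trans (shift-cong p (tile-⊕ a b xs) n) (shift-⊕ p _ _ n)))
            (swap (x * a n) (x * b n) (shift p (tile a xs) n) (shift p (tile b xs) n))
      where
      swap : ∀ u v w z → u + v + (w + z) ≡ u + w + (v + z)
      swap = solve-∀

    tile-⊙ : ∀ k a e → tile (k ⊙ a) e ≗ k ⊙ tile a e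
    tile-⊙ k a []       n = sym (*-zeroʳ k)
    tile-⊙ k a (x ∷ xs) n =
      trans (cong₂ _+_ (x*[k*y]≡k*[x*y] x k (a n)) (trans (shift-cong p (tile-⊙ k a xs) n) (shift-⊙ p k _ n)))
            (sym (*-distribˡ-+ k _ _))
      where
      x*[k*y]≡k*[x*y] : ∀ x k y → x * (k * y) ≡ k * (x * y)
      x*[k*y]≡k*[x*y] = solve-∀

    tile-shift : ∀ k a e → tile (shift k a) e ≗ shift k (tile a e)
    tile-shift k a []       n = sym (shift-0ₛ k n)
    tile-shift k a (x ∷ xs) =
      ≗-trans (⊕-cong {b′ = shift k (shift p (tile a xs))} (≗-sym (shift-⊙ k x a))
                      (≗-trans (shift-cong p (tile-shift k a xs)) (shift-comm p k (tile a xs))))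
              (≗-sym (shift-⊕ k (x ⊙ a) (shift p (tile a xs))))

    Δ-tile : ∀ a e → Δ (tile a e) ≗ tile (Δ a) e
    Δ-tile a e n = sym (trans (tile-⊕ a (-1ℤ ⊙ shift₁ a) e n)
      (cong (tile a e n +_) (trans (tile-⊙ -1ℤ (shift₁ a) e n) (cong (-1ℤ *_) (tile-shift 1 a e n)))))

    ⋆-tileʳ : ∀ a a′ e → a ⋆ tile a′ e ≗ tile (a ⋆ a′) e
    ⋆-tileʳ a a′ []       = ⋆-zeroʳ a
    ⋆-tileʳ a a′ (x ∷ xs) =
      ≗-trans (⋆-distribˡ-⊕ a (x ⊙ a′) (shift p (tile a′ xs)))
              (⊕-cong (⋆-⊙ʳ x a a′) (≗-trans (⋆-shiftʳ p a (tile a′ xs)) (shift-cong p (⋆-tileʳ a a′ xs))))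

    tile-⋆-tile : ∀ a a′ e e′ → tile a e ⋆ tile a′ e′ ≗ tile (a ⋆ a′) (e *ₚ e′)
    tile-⋆-tile a a′ []       e′ = ⋆-zeroˡ (tile a′ e′)
    tile-⋆-tile a a′ (x ∷ xs) e′ = begin
      (x ⊙ a ⊕ shift p (tile a xs)) ⋆ t′              ≈⟨ ⋆-distribʳ-⊕ (x ⊙ a) (shift p (tile a xs)) t′ ⟩
      (x ⊙ a) ⋆ t′ ⊕ shift p (tile a xs) ⋆ t′         ≈⟨ ⊕-cong (≗-trans (⋆-⊙ˡ x a t′) (⊙-cong x (⋆-tileʳ a a′ e′)))
                                                                (≗-trans (⋆-shiftˡ p (tile a xs) t′) (shift-cong p (tile-⋆-tile a a′ xs e′))) ⟩
      x ⊙ tile c e′ ⊕ shift p (tile c (xs *ₚ e′))      ≈⟨ ⊕-cong (tile-·ₚ x c e′) (tile-0∷ c (xs *ₚ e′)) ⟨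
      tile c (x ·ₚ e′) ⊕ tile c (0ℤ ∷ xs *ₚ e′)        ≈⟨ tile-+ₚ c (x ·ₚ e′) (0ℤ ∷ xs *ₚ e′) ⟨
      tile c (x ·ₚ e′ +ₚ (0ℤ ∷ xs *ₚ e′))             ∎
      where
      open ≗-Reasoning
      t′ = tile a′ e′
      c  = a ⋆ a′

    tile-≥ : ∀ a → (∀ m → p ℕ.≤ m → a m ≡ 0ℤ) → ∀ e n → length e ℕ.* p ℕ.≤ n → tile a e n ≡ 0ℤ
    tile-≥ a a≥ []       n _  = refl
    tile-≥ a a≥ (x ∷ xs) n le =
      trans (cong₂ _+_ (trans (cong (x *_) (a≥ n p≤n)) (*-zeroʳ x))
                       (trans (shift-≥ p (tile a xs) n p≤n)
                              (tile-≥ a a≥ xs (n ∸ p) (ℕ.≤-trans (ℕ.≤-reflexive (sym (ℕ.m+n∸m≡n p _))) (ℕ.∸-monoˡ-≤ p le)))))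
            refl
      where
      p≤n : p ℕ.≤ n
      p≤n = ℕ.≤-trans (ℕ.m≤m+n p _) le

    tile-bound : ∀ a → (∀ m → p ℕ.≤ m → a m ≡ 0ℤ) → (∀ m → ∣ a m ∣ ℕ.≤ 1) →
                 ∀ e B → (∀ i → ∣ coeff e i ∣ ℕ.≤ B) → ∀ n → ∣ tile a e n ∣ ℕ.≤ B
    tile-bound a a≥ ∣a∣≤1 []       B ∣e∣≤B n = z≤n
    tile-bound a a≥ ∣a∣≤1 (x ∷ xs) B ∣e∣≤B n with n ℕ.<? p
    ... | yes n<p = subst (λ z → ∣ z ∣ ℕ.≤ B)
                      (sym (trans (cong (x * a n +_) (shift-< p (tile a xs) n n<p)) (+-identityʳ (x * a n))))
                      (subst (ℕ._≤ B) (sym (abs-* x (a n)))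
                         (ℕ.≤-trans (ℕ.*-monoʳ-≤ ∣ x ∣ (∣a∣≤1 n)) (ℕ.≤-trans (ℕ.≤-reflexive (ℕ.*-identityʳ ∣ x ∣)) (∣e∣≤B 0))))
    ... | no n≮p = subst (λ z → ∣ z ∣ ℕ.≤ B)
                      (sym (trans (cong₂ _+_ (trans (cong (x *_) (a≥ n p≤n)) (*-zeroʳ x)) (shift-≥ p (tile a xs) n p≤n))
                                  (+-identityˡ (tile a xs (n ∸ p)))))
                      (tile-bound a a≥ ∣a∣≤1 xs B (λ i → ∣e∣≤B (suc i)) (n ∸ p))
      where
      p≤n : p ℕ.≤ n
      p≤n = ℕ.≮⇒≥ n≮p

  open Tile public

  coeff-tile : ∀ e → coeff e ≗ tile 1 δ e
  coeff-tile []       n       = refl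
  coeff-tile (x ∷ xs) zero    = sym (trans (+-identityʳ (x * 1ℤ)) (*-identityʳ x))
  coeff-tile (x ∷ xs) (suc n) =
    sym (trans (cong (_+ tile 1 δ xs n) (*-zeroʳ x)) (trans (+-identityˡ _) (sym (coeff-tile xs n))))

  coeff-*ₚ : ∀ x y → coeff (x *ₚ y) ≗ coeff x ⋆ coeff y
  coeff-*ₚ x y = begin
    coeff (x *ₚ y)            ≈⟨ coeff-tile (x *ₚ y) ⟩
    tile 1 δ (x *ₚ y)         ≈⟨ tile-cong 1 (x *ₚ y) (⋆-identityˡ δ) ⟨
    tile 1 (δ ⋆ δ) (x *ₚ y)   ≈⟨ tile-⋆-tile 1 δ δ x y ⟨
    tile 1 δ x ⋆ tile 1 δ y   ≈⟨ ⋆-cong (coeff-tile x) (coeff-tile y) ⟨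
    coeff x ⋆ coeff y         ∎
    where open ≗-Reasoning

module Shapes where

  open import Data.Nat as ℕ using (ℕ; zero; suc; _∸_; z≤n; s≤s; _≡ᵇ_)
  import Data.Nat.Properties as ℕ
  open import Data.Integer using (ℤ; +_; _+_; _*_; 0ℤ; 1ℤ; -1ℤ; ∣_∣)
  open import Data.Integer.Properties
  open import Data.Bool using (if_then_else_)
  open import Data.Product using (_,_)
  open import Data.Sum using (inj₁; inj₂)
  open import Relation.Binary.PropositionalEquality
  open Sequences

  box : ℕ → Seq
  box zero    i       = 0ℤ
  box (suc N) zero    = 1ℤ
  box (suc N) (suc i) = box N i

  box-< : ∀ N m → m ℕ.< N → box N m ≡ 1ℤ
  box-< (suc N) zero    _         = refl
  box-< (suc N) (suc m) (s≤s m<N) = box-< N m m<N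

  box-≥ : ∀ N m → N ℕ.≤ m → box N m ≡ 0ℤ
  box-≥ zero    m       _         = refl
  box-≥ (suc N) (suc m) (s≤s N≤m) = box-≥ N m N≤m

  ∣box∣≤1 : ∀ N m → ∣ box N m ∣ ℕ.≤ 1
  ∣box∣≤1 zero    m       = z≤n
  ∣box∣≤1 (suc N) zero    = ℕ.≤-refl
  ∣box∣≤1 (suc N) (suc m) = ∣box∣≤1 N m

  box-+ : ∀ k N m → k ℕ.≤ m → box (k ℕ.+ N) m ≡ box N (m ∸ k)
  box-+ zero    N m       _         = refl
  box-+ (suc k) N (suc m) (s≤s k≤m) = box-+ k N m k≤m

  Δ-box : ∀ N → Δ (box N) ≗ δ ⊕ -1ℤ ⊙ shift N δ
  Δ-box zero    zero    = refl
  Δ-box zero    (suc m) = refl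
  Δ-box (suc N) zero    = refl
  Δ-box (suc N) (suc m) = trans (box-step N m) (sym (+-identityˡ _))
    where
    box-step : ∀ N m → box N m + -1ℤ * box (suc N) m ≡ -1ℤ * shift N δ m
    box-step zero    zero    = refl
    box-step zero    (suc m) = refl
    box-step (suc N) zero    = refl
    box-step (suc N) (suc m) = box-step N m

  Δbox-⋆ : ∀ N g → Δ (box N) ⋆ g ≗ Δ⟨ N ⟩ g
  Δbox-⋆ N g = begin
    Δ (box N) ⋆ g                   ≈⟨ ⋆-cong {b = g} (Δ-box N) (λ _ → refl) ⟩
    (δ ⊕ -1ℤ ⊙ shift N δ) ⋆ g       ≈⟨ ⋆-distribʳ-⊕ δ (-1ℤ ⊙ shift N δ) g ⟩
    δ ⋆ g ⊕ (-1ℤ ⊙ shift N δ) ⋆ g   ≈⟨ ⊕-cong (⋆-identityˡ g) (≗-trans (⋆-⊙ˡ -1ℤ (shift N δ) g) (⊙-cong -1ℤ (δshift-⋆ N g))) ⟩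
    Δ⟨ N ⟩ g                        ∎
    where open ≗-Reasoning

  ⋆-Δbox : ∀ N g → g ⋆ Δ (box N) ≗ Δ⟨ N ⟩ g
  ⋆-Δbox N g = begin
    g ⋆ Δ (box N)                   ≈⟨ ⋆-cong {a = g} (λ _ → refl) (Δ-box N) ⟩
    g ⋆ (δ ⊕ -1ℤ ⊙ shift N δ)       ≈⟨ ⋆-distribˡ-⊕ g δ (-1ℤ ⊙ shift N δ) ⟩
    g ⋆ δ ⊕ g ⋆ (-1ℤ ⊙ shift N δ)   ≈⟨ ⊕-cong (⋆-identityʳ g) (≗-trans (⋆-⊙ʳ -1ℤ g (shift N δ)) (⊙-cong -1ℤ (⋆-δshift N g))) ⟩
    Δ⟨ N ⟩ g                        ∎
    where open ≗-Reasoning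

  ∣Δ⟨⟩∣≤1 : ∀ N φ → (∀ m → N ℕ.≤ m → φ m ≡ 0ℤ) → (∀ m → ∣ φ m ∣ ℕ.≤ 1) → ∀ n → ∣ (Δ⟨ N ⟩ φ) n ∣ ℕ.≤ 1
  ∣Δ⟨⟩∣≤1 N φ φ≥ ∣φ∣≤1 n with ℕ.<-≤-connex n N
  ... | inj₁ n<N = subst (λ z → ∣ z ∣ ℕ.≤ 1)
                     (sym (trans (cong (λ z → φ n + -1ℤ * z) (shift-< N φ n n<N)) (+-identityʳ (φ n))))
                     (∣φ∣≤1 n)
  ... | inj₂ N≤n = subst (λ z → ∣ z ∣ ℕ.≤ 1)
                     (sym (trans (cong₂ (λ y z → y + -1ℤ * z) (φ≥ n N≤n) (shift-≥ N φ n N≤n)) (+-identityˡ (-1ℤ * φ (n ∸ N)))))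
                     (subst (ℕ._≤ 1) (sym (trans (abs-* -1ℤ (φ (n ∸ N))) (ℕ.+-identityʳ ∣ φ (n ∸ N) ∣))) (∣φ∣≤1 (n ∸ N)))

  blockSign : ℕ → Seq
  blockSign zero    zero    = 1ℤ
  blockSign zero    (suc i) = 0ℤ
  blockSign (suc d) zero    = -1ℤ
  blockSign (suc d) (suc i) = blockSign d i

  blockSign-< : ∀ d m → m ℕ.< suc d → blockSign d m ≡ (if d ≡ᵇ m then 1ℤ else -1ℤ)
  blockSign-< zero    zero    _         = refl
  blockSign-< zero    (suc m) (s≤s ())
  blockSign-< (suc d) zero    _         = refl
  blockSign-< (suc d) (suc m) (s≤s m<d) = blockSign-< d m m<d

  blockSign-≥ : ∀ d m → suc d ℕ.≤ m → blockSign d m ≡ 0ℤ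
  blockSign-≥ zero    (suc m) _         = refl
  blockSign-≥ (suc d) (suc m) (s≤s d<m) = blockSign-≥ d m d<m

  ∣blockSign∣≤1 : ∀ d m → ∣ blockSign d m ∣ ℕ.≤ 1
  ∣blockSign∣≤1 zero    zero    = ℕ.≤-refl
  ∣blockSign∣≤1 zero    (suc m) = z≤n
  ∣blockSign∣≤1 (suc d) zero    = ℕ.≤-refl
  ∣blockSign∣≤1 (suc d) (suc m) = ∣blockSign∣≤1 d m

  Δ-blockSign : ∀ d → Δ (blockSign d) ≗ -1ℤ ⊙ shift 0 δ ⊕ (+ 2 ⊙ shift d δ ⊕ -1ℤ ⊙ shift (suc d) δ)
  Δ-blockSign zero    zero    = refl
  Δ-blockSign (suc d) zero    = refl
  Δ-blockSign d       (suc m) = trans (step d m) (sym (+-identityˡ _))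
    where
    step : ∀ d m → blockSign d (suc m) + -1ℤ * blockSign d m ≡ + 2 * shift d δ (suc m) + -1ℤ * shift d δ m
    step zero          zero    = refl
    step zero          (suc m) = refl
    step (suc zero)    zero    = refl
    step (suc (suc d)) zero    = refl
    step (suc d)       (suc m) = step d m

  Δ-blockSign-⋆ : ∀ d g → Δ (blockSign d) ⋆ g ≗ -1ℤ ⊙ g ⊕ (+ 2 ⊙ shift d g ⊕ -1ℤ ⊙ shift (suc d) g)
  Δ-blockSign-⋆ d g = begin
    Δ (blockSign d) ⋆ g
      ≈⟨ ⋆-cong {b = g} (Δ-blockSign d) (λ _ → refl) ⟩
    (-1ℤ ⊙ shift 0 δ ⊕ (+ 2 ⊙ shift d δ ⊕ -1ℤ ⊙ shift (suc d) δ)) ⋆ g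
      ≈⟨ ⋆-distribʳ-⊕ (-1ℤ ⊙ δ) (+ 2 ⊙ shift d δ ⊕ -1ℤ ⊙ shift (suc d) δ) g ⟩
    (-1ℤ ⊙ shift 0 δ) ⋆ g ⊕ (+ 2 ⊙ shift d δ ⊕ -1ℤ ⊙ shift (suc d) δ) ⋆ g
      ≈⟨ ⊕-cong (scaled 0 -1ℤ) (≗-trans (⋆-distribʳ-⊕ (+ 2 ⊙ shift d δ) (-1ℤ ⊙ shift (suc d) δ) g)
                                         (⊕-cong (scaled d (+ 2)) (scaled (suc d) -1ℤ))) ⟩
    -1ℤ ⊙ g ⊕ (+ 2 ⊙ shift d g ⊕ -1ℤ ⊙ shift (suc d) g) ∎
    where
    open ≗-Reasoning
    scaled : ∀ k c → (c ⊙ shift k δ) ⋆ g ≗ c ⊙ shift k g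
    scaled k c = ≗-trans (⋆-⊙ˡ c (shift k δ) g) (⊙-cong c (δshift-⋆ k g))

module Autocorrelation where

  open import Data.Nat as ℕ using (ℕ; zero; suc; z≤n)
  import Data.Nat.Properties as ℕ
  open import Data.Integer using (ℤ; +_; _+_; _-_; _*_; 0ℤ; 1ℤ; -1ℤ; ∣_∣; _⊖_)
  open import Data.Integer.Properties
  open import Data.Integer.Tactic.RingSolver using (solve-∀)
  open import Data.Bool using (Bool; true; false; if_then_else_; _xor_)
  open import Data.List using (List; []; _∷_; map)
  open import Data.Product using (_×_; _,_)
  open import Data.Sum using (inj₁; inj₂)
  open import Relation.Binary.PropositionalEquality
  open Sequences
  open Tiling

  sign : Bool → ℤ
  sign true  = 1ℤ
  sign false = -1ℤ

  signs : List Bool → List ℤ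
  signs = map sign

  -- agreements ε j counts the pairs i < i′ with i + i′ = j and ε i = ε i′, disagreements those
  -- with ε i ≠ ε i′, and selfPairs ε j the pair i = i′.
  agreesAt disagreesAt : Bool → List Bool → ℕ → ℕ
  agreesAt b []       i       = 0
  agreesAt b (x ∷ xs) zero    = if b xor x then 0 else 1
  agreesAt b (x ∷ xs) (suc i) = agreesAt b xs i
  disagreesAt b []       i       = 0
  disagreesAt b (x ∷ xs) zero    = if b xor x then 1 else 0
  disagreesAt b (x ∷ xs) (suc i) = disagreesAt b xs i

  agreements disagreements selfPairs : List Bool → ℕ → ℕ
  agreements []       j             = 0
  agreements (b ∷ bs) zero          = 0
  agreements (b ∷ bs) (suc zero)    = agreesAt b bs 0
  agreements (b ∷ bs) (suc (suc j)) = agreements bs j ℕ.+ agreesAt b bs (suc j)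
  disagreements []       j             = 0
  disagreements (b ∷ bs) zero          = 0
  disagreements (b ∷ bs) (suc zero)    = disagreesAt b bs 0
  disagreements (b ∷ bs) (suc (suc j)) = disagreements bs j ℕ.+ disagreesAt b bs (suc j)
  selfPairs []       j             = 0
  selfPairs (b ∷ bs) zero          = 1
  selfPairs (b ∷ bs) (suc zero)    = 0
  selfPairs (b ∷ bs) (suc (suc j)) = selfPairs bs j

  Balanced : ℕ → List Bool → Set
  Balanced s ε = ∀ j → (agreements ε j ℕ.≤ disagreements ε j ℕ.+ s) × (disagreements ε j ℕ.≤ agreements ε j ℕ.+ s)

  sign*coeff : ∀ b bs i → sign b * coeff (signs bs) i ≡ + agreesAt b bs i - + disagreesAt b bs i
  sign*coeff b        []           i       = *-zeroʳ (sign b)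
  sign*coeff true     (true  ∷ xs) zero    = refl
  sign*coeff true     (false ∷ xs) zero    = refl
  sign*coeff false    (true  ∷ xs) zero    = refl
  sign*coeff false    (false ∷ xs) zero    = refl
  sign*coeff b        (x ∷ xs)     (suc i) = sign*coeff b xs i

  coeff-signs-∷ : ∀ b bs → coeff (signs (b ∷ bs)) ≗ sign b ⊙ δ ⊕ shift₁ (coeff (signs bs))
  coeff-signs-∷ b bs zero    = sym (trans (+-identityʳ _) (*-identityʳ (sign b)))
  coeff-signs-∷ b bs (suc n) = sym (trans (cong (_+ coeff (signs bs) n) (*-zeroʳ (sign b))) (+-identityˡ _))

  autocorrelation : ∀ ε j → (coeff (signs ε) ⋆ coeff (signs ε)) j
                            ≡ + selfPairs ε j + + 2 * (+ agreements ε j - + disagreements ε j)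
  autocorrelation []       j = Σ≤-zero _ j (λ i _ → refl)
  autocorrelation (b ∷ bs) j =
    trans (⋆-cong (coeff-signs-∷ b bs) (coeff-signs-∷ b bs) j) (trans (square-∷ j) (peel j))
    where
    s = sign b
    Y = coeff (signs bs)
    X = s ⊙ δ ⊕ shift₁ Y

    square-∷ : X ⋆ X ≗ s ⊙ X ⊕ (shift₁ (s ⊙ Y) ⊕ shift₁ (shift₁ (Y ⋆ Y)))
    square-∷ = begin
      X ⋆ X                                                ≈⟨ ⋆-distribʳ-⊕ (s ⊙ δ) (shift₁ Y) X ⟩
      (s ⊙ δ) ⋆ X ⊕ shift₁ Y ⋆ X                           ≈⟨ ⊕-cong (≗-trans (⋆-⊙ˡ s δ X) (⊙-cong s (⋆-identityˡ X)))
                                                                     (⋆-shift₁ˡ Y X) ⟩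
      s ⊙ X ⊕ shift₁ (Y ⋆ X)                               ≈⟨ ⊕-cong {a = s ⊙ X} (λ _ → refl) (shift₁-cong Y⋆X) ⟩
      s ⊙ X ⊕ shift₁ (s ⊙ Y ⊕ shift₁ (Y ⋆ Y))              ≈⟨ ⊕-cong {a = s ⊙ X} (λ _ → refl) (shift₁-⊕ (s ⊙ Y) _) ⟩
      s ⊙ X ⊕ (shift₁ (s ⊙ Y) ⊕ shift₁ (shift₁ (Y ⋆ Y)))   ∎
      where
      open ≗-Reasoning
      Y⋆X : Y ⋆ X ≗ s ⊙ Y ⊕ shift₁ (Y ⋆ Y)
      Y⋆X = ≗-trans (⋆-distribˡ-⊕ Y (s ⊙ δ) (shift₁ Y))
                    (⊕-cong (≗-trans (⋆-⊙ʳ s Y δ) (⊙-cong s (⋆-identityʳ Y))) (⋆-shift₁ʳ Y Y))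

    peel : ∀ j → (s ⊙ X ⊕ (shift₁ (s ⊙ Y) ⊕ shift₁ (shift₁ (Y ⋆ Y)))) j
                 ≡ + selfPairs (b ∷ bs) j + + 2 * (+ agreements (b ∷ bs) j - + disagreements (b ∷ bs) j)
    peel zero = s*s≡1 b
      where
      s*s≡1 : ∀ b → sign b * (sign b * 1ℤ + 0ℤ) + (0ℤ + 0ℤ) ≡ + 1 + + 2 * (+ 0 - + 0)
      s*s≡1 true  = refl
      s*s≡1 false = refl
    peel (suc zero) = trans (ring₁ s (Y 0)) (cong (λ z → 0ℤ + + 2 * z) (sign*coeff b bs 0))
      where
      ring₁ : ∀ s y → s * (s * 0ℤ + y) + (s * y + 0ℤ) ≡ 0ℤ + + 2 * (s * y)
      ring₁ = solve-∀
    peel (suc (suc j)) =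
      trans (ring₂ s (Y (suc j)) ((Y ⋆ Y) j))
      (trans (cong₂ (λ c z → c + + 2 * z) (autocorrelation bs j) (sign*coeff b bs (suc j)))
      (trans (ring₃ (+ selfPairs bs j) (+ agreements bs j) (+ disagreements bs j) (+ agreesAt b bs (suc j)) (+ disagreesAt b bs (suc j)))
             (cong₂ (λ x y → + selfPairs bs j + + 2 * (x - y)) (sym (pos-+ (agreements bs j) _)) (sym (pos-+ (disagreements bs j) _)))))
      where
      ring₂ : ∀ s y c → s * (s * 0ℤ + y) + (s * y + c) ≡ c + + 2 * (s * y)
      ring₂ = solve-∀
      ring₃ : ∀ dg P Q S D → dg + + 2 * (P - Q) + + 2 * (S - D) ≡ dg + + 2 * ((P + S) - (Q + D))
      ring₃ = solve-∀

  selfPairs≤1 : ∀ ε j → selfPairs ε j ℕ.≤ 1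
  selfPairs≤1 []       j             = z≤n
  selfPairs≤1 (b ∷ bs) zero          = ℕ.≤-refl
  selfPairs≤1 (b ∷ bs) (suc zero)    = z≤n
  selfPairs≤1 (b ∷ bs) (suc (suc j)) = selfPairs≤1 bs j

  ∣+m-+n∣≤o : ∀ m n o → m ℕ.≤ n ℕ.+ o → n ℕ.≤ m ℕ.+ o → ∣ + m - + n ∣ ℕ.≤ o
  ∣+m-+n∣≤o m n o m≤n+o n≤m+o with ℕ.≤-total m n
  ... | inj₁ m≤n = subst (ℕ._≤ o) (sym (trans (cong ∣_∣ (m-n≡m⊖n m n)) (∣⊖∣-≤ m≤n))) (ℕ.m≤n+o⇒m∸n≤o n m n≤m+o)
  ... | inj₂ n≤m = subst (ℕ._≤ o) (sym (trans (cong ∣_∣ (m-n≡m⊖n m n)) (trans (∣m⊖n∣≡∣n⊖m∣ m n) (∣⊖∣-≤ n≤m))))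
                         (ℕ.m≤n+o⇒m∸n≤o m n m≤n+o)

  ∣autocorrelation∣≤ : ∀ s ε → Balanced s ε → ∀ i → ∣ coeff (signs ε *ₚ signs ε) i ∣ ℕ.≤ 1 ℕ.+ 2 ℕ.* s
  ∣autocorrelation∣≤ s ε balanced i with balanced i
  ... | (P≤Q+s , Q≤P+s) =
    subst (ℕ._≤ 1 ℕ.+ 2 ℕ.* s) (sym (cong ∣_∣ (trans (coeff-*ₚ (signs ε) (signs ε) i) (autocorrelation ε i))))
      (ℕ.≤-trans (∣i+j∣≤∣i∣+∣j∣ (+ selfPairs ε i) (+ 2 * (+ agreements ε i - + disagreements ε i)))
        (ℕ.+-mono-≤ (selfPairs≤1 ε i)
          (subst (ℕ._≤ 2 ℕ.* s) (sym (abs-* (+ 2) (+ agreements ε i - + disagreements ε i)))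
             (ℕ.*-monoʳ-≤ 2 (∣+m-+n∣≤o (agreements ε i) (disagreements ε i) s P≤Q+s Q≤P+s)))))

module RepresentationFunction where

  open import Data.Nat as ℕ using (ℕ; zero; suc; _∸_; z≤n)
  open import Data.Integer using (ℤ; +_; _+_; _*_; -_; 0ℤ; 1ℤ; -1ℤ; _⊖_)
  open import Data.Integer.Properties
  open import Data.Bool using (Bool; true; false; if_then_else_; _∧_)
  open import Relation.Binary.PropositionalEquality
  open import Defs using (countUpTo; R; Rprev)
  open Sequences

  χ : (ℕ → Bool) → Seq
  χ C m = if C m then 1ℤ else 0ℤ

  countUpTo≡Σ≤χ : ∀ C n → + countUpTo C n ≡ Σ≤ (χ C) n
  countUpTo≡Σ≤χ C zero with C 0
  ... | true  = refl
  ... | false = refl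
  countUpTo≡Σ≤χ C (suc n) = trans (pos-+ (countUpTo C n) _) (cong₂ _+_ (countUpTo≡Σ≤χ C n) (+χ (C (suc n))))
    where
    +χ : ∀ b → + (if b then 1 else 0) ≡ (if b then 1ℤ else 0ℤ)
    +χ true  = refl
    +χ false = refl

  R≡χ⋆χ : ∀ C n → + R C n ≡ (χ C ⋆ χ C) n
  R≡χ⋆χ C n = trans (countUpTo≡Σ≤χ _ n) (Σ≤-cong n (λ i _ → χ-∧ (C i) (C (n ∸ i))))
    where
    χ-∧ : ∀ a b → (if a ∧ b then 1ℤ else 0ℤ) ≡ (if a then 1ℤ else 0ℤ) * (if b then 1ℤ else 0ℤ)
    χ-∧ true  true  = refl
    χ-∧ true  false = refl
    χ-∧ false b     = refl

  R⊖Rprev≡Δ[χ⋆χ] : ∀ C n → R C n ⊖ Rprev C n ≡ Δ (χ C ⋆ χ C) n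
  R⊖Rprev≡Δ[χ⋆χ] C zero    = trans (⊖-≥ z≤n) (trans (R≡χ⋆χ C 0) (sym (+-identityʳ _)))
  R⊖Rprev≡Δ[χ⋆χ] C (suc n) = trans (sym (m-n≡m⊖n (R C (suc n)) (R C n)))
    (cong₂ _+_ (R≡χ⋆χ C (suc n)) (trans (cong -_ (R≡χ⋆χ C n)) (sym (-1*i≡-i _))))


module Construction (d : ℕ) where

  open import Data.Nat as ℕ using (ℕ; zero; suc; _∸_; _≡ᵇ_; z≤n)
  import Data.Nat.Properties as ℕ
  open import Data.Nat.Tactic.RingSolver using () renaming (solve-∀ to ℕ-solve-∀)
  open import Data.Integer using (ℤ; +_; _+_; _*_; 0ℤ; 1ℤ; -1ℤ; ∣_∣; _⊖_)
  open import Data.Integer.Properties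
  open import Data.Bool using (Bool; true; false; if_then_else_; not)
  open import Data.List using (List; []; _∷_; map; length)
  open import Data.List.Properties using (length-map)
  open import Function using (_∘_)
  open import Relation.Nullary.Decidable using (⌊_⌋; yes; no)
  open import Relation.Binary.PropositionalEquality
  open import Defs using (R; Rprev)
  open Sequences
  open Tiling
  open Shapes
  open Autocorrelation
  open RepresentationFunction

  p : ℕ
  p = suc d

  block : Bool → ℕ → Bool
  block true  a = d ≡ᵇ a
  block false a = not (d ≡ᵇ a)

  blockSet : List Bool → ℕ → Bool
  blockSet []       m = false
  blockSet (e ∷ es) m = if ⌊ m ℕ.<? p ⌋ then block e m else blockSet es (m ∸ p)

  centred : List Bool → Seq
  centred ε = tile p (blockSign d) (signs ε)

  blockSet-< : ∀ ε m → blockSet ε m ≡ true → m ℕ.< length ε ℕ.* p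
  blockSet-< (e ∷ es) m m∈C with m ℕ.<? p
  ... | yes m<p = ℕ.≤-trans m<p (ℕ.m≤m+n p _)
  ... | no m≮p  = subst (ℕ._< p ℕ.+ length es ℕ.* p) (ℕ.m+[n∸m]≡n (ℕ.≮⇒≥ m≮p))
                        (ℕ.+-monoʳ-< p (blockSet-< es (m ∸ p) m∈C))

  ∣centred∣≤1 : ∀ ε n → ∣ centred ε n ∣ ℕ.≤ 1
  ∣centred∣≤1 ε = tile-bound p (blockSign d) (blockSign-≥ d) (∣blockSign∣≤1 d) (signs ε) 1 (∣coeff-signs∣≤1 {ε})
    where
    ∣coeff-signs∣≤1 : ∀ {ε} i → ∣ coeff (signs ε) i ∣ ℕ.≤ 1
    ∣coeff-signs∣≤1 {[]}         i       = z≤n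
    ∣coeff-signs∣≤1 {true  ∷ bs} zero    = ℕ.≤-refl
    ∣coeff-signs∣≤1 {false ∷ bs} zero    = ℕ.≤-refl
    ∣coeff-signs∣≤1 {b ∷ bs}     (suc i) = ∣coeff-signs∣≤1 {bs} i

  centred-≥ : ∀ ε n → length ε ℕ.* p ℕ.≤ n → centred ε n ≡ 0ℤ
  centred-≥ ε n = tile-≥ p (blockSign d) (blockSign-≥ d) (signs ε) n ∘ subst (λ l → l ℕ.* p ℕ.≤ n) (sym (length-map sign ε))

  two-χ : ∀ ε → + 2 ⊙ χ (blockSet ε) ≗ box (length ε ℕ.* p) ⊕ centred ε
  two-χ []       m = refl
  two-χ (e ∷ es) m with m ℕ.<? p
  ... | yes m<p rewrite box-< (p ℕ.+ length es ℕ.* p) m (ℕ.≤-trans m<p (ℕ.m≤m+n p _))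
                      | shift-< p (centred es) m m<p
                      | blockSign-< d m m<p
                      = two-block e
    where
    two-block : ∀ e → + 2 * (if block e m then 1ℤ else 0ℤ) ≡ 1ℤ + (sign e * (if d ≡ᵇ m then 1ℤ else -1ℤ) + 0ℤ)
    two-block true  with d ≡ᵇ m
    ... | true  = refl
    ... | false = refl
    two-block false with d ≡ᵇ m
    ... | true  = refl
    ... | false = refl
  ... | no m≮p rewrite box-+ p (length es ℕ.* p) m (ℕ.≮⇒≥ m≮p)
                     | shift-≥ p (centred es) m (ℕ.≮⇒≥ m≮p)
                     | blockSign-≥ d m (ℕ.≮⇒≥ m≮p)
                     | *-zeroʳ (sign e)
                     | +-identityˡ (centred es (m ∸ p))
                     = two-χ es (m ∸ p)

  module _ (ε : List Bool) where

    private
      N  = length ε ℕ.* p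
      C  = blockSet ε
      h  = blockSign d
      f  = centred ε
      g  = box N ⊕ f
      EE = signs ε *ₚ signs ε
      K  = tile p h EE

    Δg⋆g≗4Δ[χ⋆χ] : Δ g ⋆ g ≗ + 4 ⊙ Δ (χ C ⋆ χ C)
    Δg⋆g≗4Δ[χ⋆χ] = begin
      Δ g ⋆ g                              ≈⟨ ⋆-cong (Δ⟨⟩-cong 1 (≗-sym (two-χ ε))) (≗-sym (two-χ ε)) ⟩
      Δ (+ 2 ⊙ χ C) ⋆ (+ 2 ⊙ χ C)          ≈⟨ ⋆-cong {b = + 2 ⊙ χ C} (Δ⟨⟩-⊙ 1 (+ 2) (χ C)) (λ _ → refl) ⟩
      (+ 2 ⊙ Δ (χ C)) ⋆ (+ 2 ⊙ χ C)        ≈⟨ ⋆-⊙ˡ (+ 2) (Δ (χ C)) (+ 2 ⊙ χ C) ⟩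
      + 2 ⊙ (Δ (χ C) ⋆ (+ 2 ⊙ χ C))        ≈⟨ ⊙-cong (+ 2) (⋆-⊙ʳ (+ 2) (Δ (χ C)) (χ C)) ⟩
      + 2 ⊙ (+ 2 ⊙ (Δ (χ C) ⋆ χ C))        ≈⟨ ⊙-cong (+ 2) (⊙-cong (+ 2) (⋆-Δ⟨⟩ˡ 1 (χ C) (χ C))) ⟩
      + 2 ⊙ (+ 2 ⊙ Δ (χ C ⋆ χ C))          ≈⟨ (λ n → sym (*-assoc (+ 2) (+ 2) _)) ⟩
      + 4 ⊙ Δ (χ C ⋆ χ C)                  ∎
      where open ≗-Reasoning

    Δf⋆f≗ : Δ f ⋆ f ≗ -1ℤ ⊙ K ⊕ (+ 2 ⊙ shift d K ⊕ -1ℤ ⊙ shift (suc d) K)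
    Δf⋆f≗ = begin
      Δ f ⋆ f                                                 ≈⟨ ⋆-cong {b = f} (Δ-tile p h (signs ε)) (λ _ → refl) ⟩
      tile p (Δ h) (signs ε) ⋆ tile p h (signs ε)             ≈⟨ tile-⋆-tile p (Δ h) h (signs ε) (signs ε) ⟩
      tile p (Δ h ⋆ h) EE                                     ≈⟨ tile-cong p EE (Δ-blockSign-⋆ d h) ⟩
      tile p (-1ℤ ⊙ h ⊕ (+ 2 ⊙ shift d h ⊕ -1ℤ ⊙ shift (suc d) h)) EE
        ≈⟨ tile-⊕ p (-1ℤ ⊙ h) (+ 2 ⊙ shift d h ⊕ -1ℤ ⊙ shift (suc d) h) EE ⟩
      tile p (-1ℤ ⊙ h) EE ⊕ tile p (+ 2 ⊙ shift d h ⊕ -1ℤ ⊙ shift (suc d) h) EE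
        ≈⟨ ⊕-cong (tile-⊙ p -1ℤ h EE)
                  (≗-trans (tile-⊕ p (+ 2 ⊙ shift d h) (-1ℤ ⊙ shift (suc d) h) EE)
                           (⊕-cong (scaled-shift (+ 2) d) (scaled-shift -1ℤ (suc d)))) ⟩
      -1ℤ ⊙ K ⊕ (+ 2 ⊙ shift d K ⊕ -1ℤ ⊙ shift (suc d) K)     ∎
      where
      open ≗-Reasoning
      scaled-shift : ∀ c k → tile p (c ⊙ shift k h) EE ≗ c ⊙ shift k K
      scaled-shift c k = ≗-trans (tile-⊙ p c (shift k h) EE) (⊙-cong c (tile-shift p k h EE))

    Δg⋆g≗ : Δ g ⋆ g ≗ (Δ⟨ N ⟩ box N ⊕ Δ⟨ N ⟩ f) ⊕ (Δ⟨ N ⟩ f ⊕ Δ f ⋆ f)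
    Δg⋆g≗ = begin
      Δ g ⋆ g                                          ≈⟨ ⋆-cong {b = g} (Δ⟨⟩-⊕ 1 (box N) f) (λ _ → refl) ⟩
      (Δ (box N) ⊕ Δ f) ⋆ g                            ≈⟨ ⋆-distribʳ-⊕ (Δ (box N)) (Δ f) g ⟩
      Δ (box N) ⋆ g ⊕ Δ f ⋆ g                          ≈⟨ ⊕-cong (≗-trans (Δbox-⋆ N g) (Δ⟨⟩-⊕ N (box N) f))
                                                                 (⋆-distribˡ-⊕ (Δ f) (box N) f) ⟩
      (Δ⟨ N ⟩ box N ⊕ Δ⟨ N ⟩ f) ⊕ (Δ f ⋆ box N ⊕ Δ f ⋆ f)
        ≈⟨ ⊕-cong {a = Δ⟨ N ⟩ box N ⊕ Δ⟨ N ⟩ f} (λ _ → refl) (⊕-cong {b = Δ f ⋆ f} Δf⋆box (λ _ → refl)) ⟩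
      (Δ⟨ N ⟩ box N ⊕ Δ⟨ N ⟩ f) ⊕ (Δ⟨ N ⟩ f ⊕ Δ f ⋆ f) ∎
      where
      open ≗-Reasoning
      Δf⋆box : Δ f ⋆ box N ≗ Δ⟨ N ⟩ f
      Δf⋆box = ≗-trans (⋆-Δ⟨⟩ˡ 1 f (box N)) (≗-trans (≗-sym (⋆-Δ⟨⟩ʳ 1 f (box N))) (⋆-Δbox N f))

    ΔR-bound : ∀ c → (∀ i → ∣ coeff EE i ∣ ℕ.≤ c) → ∀ n → ∣ R C n ⊖ Rprev C n ∣ ℕ.≤ c
    ΔR-bound c ∣EE∣≤c n = ℕ.≤-pred (ℕ.*-cancelˡ-< 4 _ _ (begin-strict
      4 ℕ.* ∣ D ∣                                         ≡⟨ abs-* (+ 4) D ⟨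
      ∣ + 4 * D ∣                                         ≡⟨ cong (λ z → ∣ + 4 * z ∣) (R⊖Rprev≡Δ[χ⋆χ] C n) ⟩
      ∣ + 4 * Δ (χ C ⋆ χ C) n ∣                           ≡⟨ cong ∣_∣ (trans (sym (Δg⋆g≗4Δ[χ⋆χ] n)) (Δg⋆g≗ n)) ⟩
      ∣ (a + b) + (b + t) ∣                               ≤⟨ ∣i+j∣≤m+n (a + b) (b + t) (∣i+j∣≤m+n a b edge-box edge-f)
                                                                                               (∣i+j∣≤m+n b t edge-f ∣Δf⋆f∣≤) ⟩
      (1 ℕ.+ 1) ℕ.+ (1 ℕ.+ (c ℕ.+ (2 ℕ.* c ℕ.+ c)))       <⟨ ℕ.≤-reflexive (arith c) ⟩
      4 ℕ.* suc c                                         ∎))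
      where
      open ℕ.≤-Reasoning
      D = R C n ⊖ Rprev C n
      a = (Δ⟨ N ⟩ box N) n
      b = (Δ⟨ N ⟩ f) n
      t = (Δ f ⋆ f) n
      edge-box : ∣ a ∣ ℕ.≤ 1
      edge-box = ∣Δ⟨⟩∣≤1 N (box N) (box-≥ N) (∣box∣≤1 N) n
      edge-f : ∣ b ∣ ℕ.≤ 1
      edge-f = ∣Δ⟨⟩∣≤1 N f (centred-≥ ε) (∣centred∣≤1 ε) n
      ∣K∣≤c : ∀ m → ∣ K m ∣ ℕ.≤ c
      ∣K∣≤c = tile-bound p h (blockSign-≥ d) (∣blockSign∣≤1 d) EE c ∣EE∣≤c
      ∣Δf⋆f∣≤ : ∣ t ∣ ℕ.≤ c ℕ.+ (2 ℕ.* c ℕ.+ c)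
      ∣Δf⋆f∣≤ = subst (λ z → ∣ z ∣ ℕ.≤ c ℕ.+ (2 ℕ.* c ℕ.+ c)) (sym (Δf⋆f≗ n))
        (∣i+j∣≤m+n (-1ℤ * K n) (+ 2 * shift d K n + -1ℤ * shift (suc d) K n)
          (ℕ.≤-trans (ℕ.≤-reflexive (∣-1*i∣≡∣i∣ (K n))) (∣K∣≤c n))
          (∣i+j∣≤m+n (+ 2 * shift d K n) (-1ℤ * shift (suc d) K n) (ℕ.≤-trans (ℕ.≤-reflexive (abs-* (+ 2) (shift d K n))) (ℕ.*-monoʳ-≤ 2 (∣shift∣≤ d K c ∣K∣≤c n)))
                     (ℕ.≤-trans (ℕ.≤-reflexive (∣-1*i∣≡∣i∣ (shift (suc d) K n))) (∣shift∣≤ (suc d) K c ∣K∣≤c n))))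
      arith : ∀ c → suc ((1 ℕ.+ 1) ℕ.+ (1 ℕ.+ (c ℕ.+ (2 ℕ.* c ℕ.+ c)))) ≡ 4 ℕ.* suc c
      arith = ℕ-solve-∀

module SignVectors where

  open import Data.Nat
  open import Data.Nat.Properties
  open import Data.Nat.Tactic.RingSolver using (solve-∀)
  open import Data.Bool using (Bool; true; false)
  open import Data.List using (List; []; _∷_; _++_; map; length)
  open import Data.List.Properties using (length-++; length-map)
  open import Data.List.Relation.Unary.All as All using (All; []; _∷_)
  open import Data.List.Relation.Unary.All.Properties using (++⁺; map⁺)
  open import Data.Product using (Σ; _×_; _,_)
  open import Relation.Binary.PropositionalEquality
  open ≡-Reasoning
  open Autocorrelation using (agreesAt; disagreesAt; agreements; disagreements)

  ∑ : {A : Set} → (A → ℕ) → List A → ℕ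
  ∑ F []       = 0
  ∑ F (x ∷ xs) = F x + ∑ F xs

  ∑-++ : ∀ {A : Set} (F : A → ℕ) xs ys → ∑ F (xs ++ ys) ≡ ∑ F xs + ∑ F ys
  ∑-++ F []       ys = refl
  ∑-++ F (x ∷ xs) ys = trans (cong (F x +_) (∑-++ F xs ys)) (sym (+-assoc (F x) _ _))

  ∑-map : ∀ {A B : Set} (F : B → ℕ) (g : A → B) xs → ∑ F (map g xs) ≡ ∑ (λ x → F (g x)) xs
  ∑-map F g []       = refl
  ∑-map F g (x ∷ xs) = cong (F (g x) +_) (∑-map F g xs)

  ∑-+ : ∀ {A : Set} (F G : A → ℕ) xs → ∑ (λ x → F x + G x) xs ≡ ∑ F xs + ∑ G xs
  ∑-+ F G []       = refl
  ∑-+ F G (x ∷ xs) rewrite ∑-+ F G xs = swap (F x) (G x) (∑ F xs) (∑ G xs)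
    where
    swap : ∀ a b c d → a + b + (c + d) ≡ a + c + (b + d)
    swap = solve-∀

  ∑-*ʳ : ∀ {A : Set} (F : A → ℕ) c xs → ∑ (λ x → F x * c) xs ≡ ∑ F xs * c
  ∑-*ʳ F c []       = refl
  ∑-*ʳ F c (x ∷ xs) rewrite ∑-*ʳ F c xs = sym (*-distribʳ-+ c (F x) (∑ F xs))

  ∑-const : ∀ {A : Set} c (xs : List A) → ∑ (λ _ → c) xs ≡ length xs * c
  ∑-const c []       = refl
  ∑-const c (x ∷ xs) = cong (c +_) (∑-const c xs)

  ∑-cong : ∀ {A : Set} {F G : A → ℕ} {xs} → All (λ x → F x ≡ G x) xs → ∑ F xs ≡ ∑ G xs
  ∑-cong []              = refl
  ∑-cong (Fx≡Gx ∷ F≡G) = cong₂ _+_ Fx≡Gx (∑-cong F≡G)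

  ∑-mono-≤ : ∀ {A : Set} {F G : A → ℕ} {xs} → All (λ x → F x ≤ G x) xs → ∑ F xs ≤ ∑ G xs
  ∑-mono-≤ []            = z≤n
  ∑-mono-≤ (Fx≤Gx ∷ F≤G) = +-mono-≤ Fx≤Gx (∑-mono-≤ F≤G)

  ∑-comm : ∀ {A B : Set} (F : A → B → ℕ) xs ys → ∑ (λ x → ∑ (F x) ys) xs ≡ ∑ (λ y → ∑ (λ x → F x y) xs) ys
  ∑-comm F []       ys = sym (∑-zeros ys)
    where
    ∑-zeros : ∀ {B : Set} (ys : List B) → ∑ (λ _ → 0) ys ≡ 0
    ∑-zeros []       = refl
    ∑-zeros (y ∷ ys) = ∑-zeros ys
  ∑-comm F (x ∷ xs) ys = trans (cong (∑ (F x) ys +_) (∑-comm F xs ys)) (sym (∑-+ (F x) _ ys))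

  ∑≡0 : ∀ {A : Set} {F : A → ℕ} xs → ∑ F xs ≡ 0 → All (λ x → F x ≡ 0) xs
  ∑≡0 []       _     = []
  ∑≡0 (x ∷ xs) sum≡0 = m+n≡0⇒m≡0 _ sum≡0 ∷ ∑≡0 xs (m+n≡0⇒n≡0 _ sum≡0)

  pigeonhole : ∀ {A : Set} {P : A → Set} (F : A → ℕ) xs → All P xs → ∑ F xs < length xs → Σ A (λ x → P x × F x ≡ 0)
  pigeonhole F (x ∷ xs) (px ∷ pxs) sum<len with F x in Fx≡
  ... | zero  = x , px , Fx≡
  ... | suc n = pigeonhole F xs pxs (≤-trans (s≤s (m≤n+m (∑ F xs) n)) (≤-pred sum<len))

  signVectors : ℕ → List (List Bool)
  signVectors zero    = [] ∷ []
  signVectors (suc M) = map (true ∷_) (signVectors M) ++ map (false ∷_) (signVectors M)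

  length-signVectors : ∀ M → length (signVectors M) ≡ 2 ^ M
  length-signVectors zero    = refl
  length-signVectors (suc M) = begin
    length (map (true ∷_) V ++ map (false ∷_) V)   ≡⟨ length-++ (map (true ∷_) V) ⟩
    length (map (true ∷_) V) + length (map (false ∷_) V)
                                                   ≡⟨ cong₂ _+_ (length-map (true ∷_) V) (length-map (false ∷_) V) ⟩
    length V + length V                            ≡⟨ cong (λ l → l + l) (length-signVectors M) ⟩
    2 ^ M + 2 ^ M                                  ≡⟨ cong (2 ^ M +_) (+-identityʳ (2 ^ M)) ⟨
    2 ^ suc M                                      ∎
    where V = signVectors M

  signVectors-length : ∀ M → All (λ ε → length ε ≡ M) (signVectors M)
  signVectors-length zero    = refl ∷ []
  signVectors-length (suc M) = ++⁺ (map⁺ (All.map (cong suc) (signVectors-length M)))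
                                   (map⁺ (All.map (cong suc) (signVectors-length M)))

  ∑-signVectors-suc : ∀ M (F : List Bool → ℕ) →
                      ∑ F (signVectors (suc M)) ≡ ∑ (λ ε → F (true ∷ ε) + F (false ∷ ε)) (signVectors M)
  ∑-signVectors-suc M F = begin
    ∑ F (map (true ∷_) V ++ map (false ∷_) V)          ≡⟨ ∑-++ F (map (true ∷_) V) (map (false ∷_) V) ⟩
    ∑ F (map (true ∷_) V) + ∑ F (map (false ∷_) V)     ≡⟨ cong₂ _+_ (∑-map F (true ∷_) V) (∑-map F (false ∷_) V) ⟩
    ∑ (λ ε → F (true ∷ ε)) V + ∑ (λ ε → F (false ∷ ε)) V ≡⟨ ∑-+ (λ ε → F (true ∷ ε)) (λ ε → F (false ∷ ε)) V ⟨
    ∑ (λ ε → F (true ∷ ε) + F (false ∷ ε)) V           ∎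
    where V = signVectors M

  -- pairs M j is the number of pairs i < i′ < M with i + i′ = j.
  inRange : ℕ → ℕ → ℕ
  inRange i       zero    = 0
  inRange zero    (suc M) = 1
  inRange (suc i) (suc M) = inRange i M

  pairs : ℕ → ℕ → ℕ
  pairs zero    j             = 0
  pairs (suc M) zero          = 0
  pairs (suc M) (suc zero)    = inRange 0 M
  pairs (suc M) (suc (suc j)) = pairs M j + inRange (suc j) M

  agreesAt+disagreesAt : ∀ b bs i → agreesAt b bs i + disagreesAt b bs i ≡ inRange i (length bs)
  agreesAt+disagreesAt b     []           i       = refl
  agreesAt+disagreesAt true  (true  ∷ xs) zero    = refl
  agreesAt+disagreesAt true  (false ∷ xs) zero    = refl
  agreesAt+disagreesAt false (true  ∷ xs) zero    = refl
  agreesAt+disagreesAt false (false ∷ xs) zero    = refl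
  agreesAt+disagreesAt b     (x ∷ xs)     (suc i) = agreesAt+disagreesAt b xs i

  agreements+disagreements : ∀ ε j → agreements ε j + disagreements ε j ≡ pairs (length ε) j
  agreements+disagreements []       j             = refl
  agreements+disagreements (b ∷ bs) zero          = refl
  agreements+disagreements (b ∷ bs) (suc zero)    = agreesAt+disagreesAt b bs 0
  agreements+disagreements (b ∷ bs) (suc (suc j)) =
    trans (swap (agreements bs j) (disagreements bs j) (agreesAt b bs (suc j)) (disagreesAt b bs (suc j)))
          (cong₂ _+_ (agreements+disagreements bs j) (agreesAt+disagreesAt b bs (suc j)))
    where
    swap : ∀ a b c d → a + c + (b + d) ≡ a + b + (c + d)
    swap = solve-∀

  inRange≤1 : ∀ i M → inRange i M ≤ 1
  inRange≤1 i       zero    = z≤n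
  inRange≤1 zero    (suc M) = s≤s z≤n
  inRange≤1 (suc i) (suc M) = inRange≤1 i M

  pairs≤ : ∀ M j → pairs M j ≤ M
  pairs≤ zero    j             = z≤n
  pairs≤ (suc M) zero          = z≤n
  pairs≤ (suc M) (suc zero)    = ≤-trans (inRange≤1 0 M) (s≤s z≤n)
  pairs≤ (suc M) (suc (suc j)) =
    subst (_≤ suc M) (+-comm (inRange (suc j) M) (pairs M j)) (+-mono-≤ (inRange≤1 (suc j) M) (pairs≤ M j))

  pairs-≥ : ∀ M j → 2 * M ≤ j → pairs M j ≡ 0
  pairs-≥ zero    j             _   = refl
  pairs-≥ (suc M) (suc zero)    2M+2≤1 with () ← subst (_≤ 0) (+-suc M (M + 0)) (≤-pred 2M+2≤1)
  pairs-≥ (suc M) (suc (suc j)) 2M+2≤j+2 = cong₂ _+_ (pairs-≥ M j 2M≤j) (inRange-≥ (suc j) M (≤-trans (m≤m+n M (M + 0)) (≤-trans 2M≤j (n≤1+n j))))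
    where
    2M≤j : 2 * M ≤ j
    2M≤j = ≤-pred (≤-pred (subst (_≤ suc (suc j)) (cong suc (+-suc M (M + 0))) 2M+2≤j+2))
    inRange-≥ : ∀ i M → M ≤ i → inRange i M ≡ 0
    inRange-≥ i       zero    _         = refl
    inRange-≥ (suc i) (suc M) (s≤s M≤i) = inRange-≥ i M M≤i

  module Weight (x y : ℕ) where

    weight : ℕ → List Bool → ℕ
    weight j ε = x ^ agreements ε j * y ^ disagreements ε j

    pairWeight : Bool → List Bool → ℕ → ℕ
    pairWeight b bs i = x ^ agreesAt b bs i * y ^ disagreesAt b bs i

    both-signs : ∀ bs i → (pairWeight true bs i + pairWeight false bs i) * 2 ^ inRange i (length bs)
                          ≡ 2 * (x + y) ^ inRange i (length bs)
    both-signs []           i       = refl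
    both-signs (true  ∷ cs) zero    = ring x y
      where
      ring : ∀ x y → (x * 1 * 1 + 1 * (y * 1)) * (2 * 1) ≡ 2 * ((x + y) * 1)
      ring = solve-∀
    both-signs (false ∷ cs) zero    = ring x y
      where
      ring : ∀ x y → (1 * (y * 1) + x * 1 * 1) * (2 * 1) ≡ 2 * ((x + y) * 1)
      ring = solve-∀
    both-signs (c ∷ cs)     (suc i) = both-signs cs i

    weight-∷ : ∀ b bs j → weight (suc (suc j)) (b ∷ bs) ≡ weight j bs * pairWeight b bs (suc j)
    weight-∷ b bs j
      rewrite ^-distribˡ-+-* x (agreements bs j) (agreesAt b bs (suc j))
            | ^-distribˡ-+-* y (disagreements bs j) (disagreesAt b bs (suc j))
            = swap (x ^ agreements bs j) (x ^ agreesAt b bs (suc j)) (y ^ disagreements bs j) (y ^ disagreesAt b bs (suc j))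
      where
      swap : ∀ a b c d → a * b * (c * d) ≡ a * c * (b * d)
      swap = solve-∀

    ∑-extend : ∀ M i (base F : List Bool → ℕ) → (∀ b bs → F (b ∷ bs) ≡ base bs * pairWeight b bs i) →
               ∑ F (signVectors (suc M)) * 2 ^ inRange i M ≡ ∑ base (signVectors M) * (2 * (x + y) ^ inRange i M)
    ∑-extend M i base F F≡ = begin
      ∑ F (signVectors (suc M)) * T                              ≡⟨ cong (_* T) (∑-signVectors-suc M F) ⟩
      ∑ (λ bs → F (true ∷ bs) + F (false ∷ bs)) V * T             ≡⟨ ∑-*ʳ _ T V ⟨
      ∑ (λ bs → (F (true ∷ bs) + F (false ∷ bs)) * T) V           ≡⟨ ∑-cong (All.map (λ {bs} → step bs) (signVectors-length M)) ⟩
      ∑ (λ bs → base bs * (2 * (x + y) ^ t)) V                    ≡⟨ ∑-*ʳ base _ V ⟩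
      ∑ base V * (2 * (x + y) ^ t)                                ∎
      where
      t = inRange i M
      T = 2 ^ t
      V = signVectors M
      step : ∀ bs → length bs ≡ M → (F (true ∷ bs) + F (false ∷ bs)) * T ≡ base bs * (2 * (x + y) ^ t)
      step bs len = begin
        (F (true ∷ bs) + F (false ∷ bs)) * T                              ≡⟨ cong (_* T) (cong₂ _+_ (F≡ true bs) (F≡ false bs)) ⟩
        (base bs * pairWeight true bs i + base bs * pairWeight false bs i) * T
                                                                          ≡⟨ cong (_* T) (*-distribˡ-+ (base bs) _ _) ⟨
        base bs * (pairWeight true bs i + pairWeight false bs i) * T      ≡⟨ *-assoc (base bs) _ T ⟩
        base bs * ((pairWeight true bs i + pairWeight false bs i) * T)    ≡⟨ cong (base bs *_) both ⟩
        base bs * (2 * (x + y) ^ t)                                       ∎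
        where
        both : (pairWeight true bs i + pairWeight false bs i) * T ≡ 2 * (x + y) ^ t
        both = subst (λ l → (pairWeight true bs i + pairWeight false bs i) * 2 ^ inRange i l ≡ 2 * (x + y) ^ inRange i l)
                     len (both-signs bs i)

    ∑weight : ∀ M j → ∑ (weight j) (signVectors M) * 2 ^ pairs M j ≡ 2 ^ M * (x + y) ^ pairs M j
    ∑weight zero    j          = refl
    ∑weight (suc M) zero       = cong (_* 1) (begin
      ∑ (weight 0) (signVectors (suc M))   ≡⟨ ∑-signVectors-suc M (weight 0) ⟩
      ∑ (λ _ → 2) (signVectors M)           ≡⟨ ∑-const 2 (signVectors M) ⟩
      length (signVectors M) * 2            ≡⟨ cong (_* 2) (length-signVectors M) ⟩
      2 ^ M * 2                             ≡⟨ *-comm (2 ^ M) 2 ⟩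
      2 ^ suc M                             ∎)
    ∑weight (suc M) (suc zero) = begin
      ∑ (weight 1) (signVectors (suc M)) * 2 ^ t   ≡⟨ ∑-extend M 0 (λ _ → 1) (weight 1) (λ b bs → sym (*-identityˡ _)) ⟩
      ∑ (λ _ → 1) (signVectors M) * (2 * (x + y) ^ t)
                                                  ≡⟨ cong (_* (2 * (x + y) ^ t)) (trans (∑-const 1 (signVectors M))
                                                       (trans (*-identityʳ _) (length-signVectors M))) ⟩
      2 ^ M * (2 * (x + y) ^ t)                   ≡⟨ ring (2 ^ M) ((x + y) ^ t) ⟩
      2 ^ suc M * (x + y) ^ t                     ∎
      where
      t = inRange 0 M
      ring : ∀ a z → a * (2 * z) ≡ 2 * a * z
      ring = solve-∀
    ∑weight (suc M) (suc (suc j)) = begin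
      S′ * 2 ^ (L + t)                             ≡⟨ cong (S′ *_) (^-distribˡ-+-* 2 L t) ⟩
      S′ * (2 ^ L * 2 ^ t)                         ≡⟨ ring₁ S′ (2 ^ L) (2 ^ t) ⟩
      S′ * 2 ^ t * 2 ^ L                           ≡⟨ cong (_* 2 ^ L) (∑-extend M (suc j) (weight j) (weight (suc (suc j))) (λ b bs → weight-∷ b bs j)) ⟩
      S * (2 * (x + y) ^ t) * 2 ^ L                ≡⟨ ring₂ S (2 * (x + y) ^ t) (2 ^ L) ⟩
      S * 2 ^ L * (2 * (x + y) ^ t)                ≡⟨ cong (_* (2 * (x + y) ^ t)) (∑weight M j) ⟩
      2 ^ M * (x + y) ^ L * (2 * (x + y) ^ t)      ≡⟨ ring₃ (2 ^ M) ((x + y) ^ L) ((x + y) ^ t) ⟩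
      2 ^ suc M * ((x + y) ^ L * (x + y) ^ t)      ≡⟨ cong (2 ^ suc M *_) (^-distribˡ-+-* (x + y) L t) ⟨
      2 ^ suc M * (x + y) ^ (L + t)                ∎
      where
      L  = pairs M j
      t  = inRange (suc j) M
      S  = ∑ (weight j) (signVectors M)
      S′ = ∑ (weight (suc (suc j))) (signVectors (suc M))
      ring₁ : ∀ a b c → a * (b * c) ≡ a * c * b
      ring₁ = solve-∀
      ring₂ : ∀ a b c → a * b * c ≡ a * c * b
      ring₂ = solve-∀
      ring₃ : ∀ a b c → a * b * (2 * c) ≡ 2 * a * (b * c)
      ring₃ = solve-∀

module Chernoff where

  open import Data.Nat
  open import Data.Nat.Properties
  open import Data.Nat.Tactic.RingSolver using (solve-∀)
  open import Data.Bool using (Bool)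
  open import Data.List using (List; []; _∷_; length; upTo)
  open import Data.List.Properties using (length-upTo)
  open import Data.List.Membership.Propositional.Properties using (∈-upTo⁺)
  open import Data.List.Relation.Unary.All as All using (All)
  open import Data.Product using (Σ; _×_; _,_)
  open import Relation.Nullary using (Dec; yes; no; ¬_)
  open import Relation.Binary.PropositionalEquality
  open Autocorrelation using (agreements; disagreements; Balanced)
  open SignVectors

  ^-distribʳ-* : ∀ m n o → (m * n) ^ o ≡ m ^ o * n ^ o
  ^-distribʳ-* m n zero    = refl
  ^-distribʳ-* m n (suc o) rewrite ^-distribʳ-* m n o = swap m n (m ^ o) (n ^ o)
    where
    swap : ∀ m n a b → m * n * (a * b) ≡ m * a * (n * b)
    swap = solve-∀

  -- Writing P = Q + s + 1 + k, the two sides are X b^k and X a^k for X = a^(2Q+2s+2+k) b^(2Q+s+1).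
  excess-weight : ∀ a b P Q s → b ≤ a → Q + s < P →
                  (a * b) ^ (P + Q) * a ^ suc s ≤ (a * a) ^ P * (b * b) ^ Q * b ^ suc s
  excess-weight a b P Q s b≤a Q+s<P with m≤n⇒∃[o]m+o≡n Q+s<P
  ... | k , refl = subst₂ _≤_ (sym lhs) (sym rhs) (*-monoʳ-≤ X (^-monoˡ-≤ k b≤a))
    where
    open ≡-Reasoning
    u = a ^ Q ; v = a ^ suc s ; w = a ^ k ; u′ = b ^ Q ; v′ = b ^ suc s ; w′ = b ^ k
    X = u * u * v * v * w * u′ * u′ * v′
    split : ∀ c → c ^ (suc (Q + s) + k) ≡ c ^ Q * c ^ suc s * c ^ k
    split c = begin
      c ^ (suc (Q + s) + k)     ≡⟨ cong (λ e → c ^ (e + k)) (+-suc Q s) ⟨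
      c ^ (Q + suc s + k)       ≡⟨ ^-distribˡ-+-* c (Q + suc s) k ⟩
      c ^ (Q + suc s) * c ^ k   ≡⟨ cong (_* c ^ k) (^-distribˡ-+-* c Q (suc s)) ⟩
      c ^ Q * c ^ suc s * c ^ k ∎
    lhs : (a * b) ^ (suc (Q + s) + k + Q) * v ≡ X * w′
    lhs = begin
      (a * b) ^ (suc (Q + s) + k + Q) * v                ≡⟨ cong (_* v) (^-distribʳ-* a b (suc (Q + s) + k + Q)) ⟩
      a ^ (suc (Q + s) + k + Q) * b ^ (suc (Q + s) + k + Q) * v
        ≡⟨ cong₂ (λ x y → x * y * v) (trans (^-distribˡ-+-* a (suc (Q + s) + k) Q) (cong (_* u) (split a)))
                                      (trans (^-distribˡ-+-* b (suc (Q + s) + k) Q) (cong (_* u′) (split b))) ⟩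
      (u * v * w * u) * (u′ * v′ * w′ * u′) * v          ≡⟨ ring u v w u′ v′ w′ ⟩
      X * w′                                             ∎
      where
      ring : ∀ u v w u′ v′ w′ → (u * v * w * u) * (u′ * v′ * w′ * u′) * v ≡ (u * u * v * v * w * u′ * u′ * v′) * w′
      ring = solve-∀
    rhs : (a * a) ^ (suc (Q + s) + k) * (b * b) ^ Q * v′ ≡ X * w
    rhs = begin
      (a * a) ^ (suc (Q + s) + k) * (b * b) ^ Q * v′
        ≡⟨ cong₂ (λ x y → x * y * v′) (trans (^-distribʳ-* a a (suc (Q + s) + k)) (cong₂ _*_ (split a) (split a))) (^-distribʳ-* b b Q) ⟩
      (u * v * w) * (u * v * w) * (u′ * u′) * v′         ≡⟨ ring u v w u′ v′ ⟩
      X * w                                              ∎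
      where
      ring : ∀ u v w u′ v′ → (u * v * w) * (u * v * w) * (u′ * u′) * v′ ≡ (u * u * v * v * w * u′ * u′ * v′) * w
      ring = solve-∀

  𝟙 : ∀ {A : Set} → Dec A → ℕ
  𝟙 (yes _) = 1
  𝟙 (no  _) = 0

  𝟙≡0⇒¬ : ∀ {A : Set} (a? : Dec A) → 𝟙 a? ≡ 0 → ¬ A
  𝟙≡0⇒¬ (no ¬a) _ = ¬a

  ∑*<length* : ∀ {A : Set} (F : A → ℕ) K T (xs : List A) → 0 < length xs → (∀ x → F x * K < T) →
               ∑ F xs * K < length xs * T
  ∑*<length* F K T (x ∷ xs) _ F*K<T = begin-strict
    (F x + ∑ F xs) * K      ≡⟨ *-distribʳ-+ K (F x) (∑ F xs) ⟩
    F x * K + ∑ F xs * K    <⟨ +-mono-<-≤ (F*K<T x) (≤-trans (≤-reflexive (sym (∑-*ʳ F K xs))) (∑≤ xs)) ⟩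
    T + length xs * T       ∎
    where
    open ≤-Reasoning
    ∑≤ : ∀ xs → ∑ (λ x → F x * K) xs ≤ length xs * T
    ∑≤ []       = z≤n
    ∑≤ (x ∷ xs) = +-mono-≤ (<⇒≤ (F*K<T x)) (∑≤ xs)

  module _ (a b s M : ℕ) (b≤a : b ≤ a) (0<M : 0 < M)
           (tail-small : ∀ L → L ≤ M → 4 * M * (b ^ suc s * (a * a + b * b) ^ L) < 2 ^ L * ((a * b) ^ L * a ^ suc s))
           where

    private
      A = a * a
      B = b * b
      V = signVectors M

    excess⁺ excess⁻ : ℕ → List Bool → ℕ
    excess⁺ j ε = 𝟙 (disagreements ε j + s <? agreements ε j)
    excess⁻ j ε = 𝟙 (agreements ε j + s <? disagreements ε j)

    -- Markov's inequality for the weights x ^ agreements * y ^ disagreements, whose total is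
    -- 2^(M − L) (x + y)^L by ∑weight.
    few-excesses : (x y : ℕ) (F : List Bool → ℕ) (j : ℕ) → x + y ≡ A + B →
                   (∀ ε → length ε ≡ M → F ε * ((a * b) ^ pairs M j * a ^ suc s) ≤ Weight.weight x y j ε * b ^ suc s) →
                   ∑ F V * (4 * M) < 2 ^ M
    few-excesses x y F j x+y≡ F≤weight = *-cancelʳ-< (2 ^ L * K) (c * (4 * M)) (2 ^ M) (begin-strict
      c * (4 * M) * (2 ^ L * K)          ≡⟨ ring₁ c (4 * M) (2 ^ L) K ⟩
      c * K * 2 ^ L * (4 * M)            ≤⟨ *-monoˡ-≤ (4 * M) (*-monoˡ-≤ (2 ^ L) c*K≤) ⟩
      ∑ W V * b ^ suc s * 2 ^ L * (4 * M) ≡⟨ cong (_* (4 * M)) (ring₂ (∑ W V) (b ^ suc s) (2 ^ L)) ⟩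
      ∑ W V * 2 ^ L * b ^ suc s * (4 * M) ≡⟨ cong (λ z → z * b ^ suc s * (4 * M)) (Weight.∑weight x y M j) ⟩
      2 ^ M * (x + y) ^ L * b ^ suc s * (4 * M)
                                          ≡⟨ cong (λ z → 2 ^ M * z ^ L * b ^ suc s * (4 * M)) x+y≡ ⟩
      2 ^ M * (A + B) ^ L * b ^ suc s * (4 * M)
                                          ≡⟨ ring₃ (2 ^ M) ((A + B) ^ L) (b ^ suc s) (4 * M) ⟩
      2 ^ M * (4 * M * (b ^ suc s * (A + B) ^ L))
                                          <⟨ *-monoʳ-< (2 ^ M) {{>-nonZero (m^n>0 2 M)}} (tail-small L (pairs≤ M j)) ⟩
      2 ^ M * (2 ^ L * K)                 ∎)
      where
      open ≤-Reasoning
      L = pairs M j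
      K = (a * b) ^ L * a ^ suc s
      W = Weight.weight x y j
      c = ∑ F V
      c*K≤ : c * K ≤ ∑ W V * b ^ suc s
      c*K≤ = subst₂ _≤_ (∑-*ʳ F K V) (∑-*ʳ W (b ^ suc s) V) (∑-mono-≤ (All.map (λ {ε} → F≤weight ε) (signVectors-length M)))
      ring₁ : ∀ c m t k → c * m * (t * k) ≡ c * k * t * m
      ring₁ = solve-∀
      ring₂ : ∀ p q r → p * q * r ≡ p * r * q
      ring₂ = solve-∀
      ring₃ : ∀ p q r m → p * q * r * m ≡ p * (m * (r * q))
      ring₃ = solve-∀

    excess⁺-weight : ∀ j ε → length ε ≡ M →
                     excess⁺ j ε * ((a * b) ^ pairs M j * a ^ suc s) ≤ Weight.weight A B j ε * b ^ suc s
    excess⁺-weight j ε len with disagreements ε j + s <? agreements ε j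
    ... | no  _     = z≤n
    ... | yes Q+s<P = subst (λ L → 1 * ((a * b) ^ L * a ^ suc s) ≤ Weight.weight A B j ε * b ^ suc s)
                            (trans (agreements+disagreements ε j) (cong (λ l → pairs l j) len))
                            (subst (_≤ Weight.weight A B j ε * b ^ suc s) (sym (*-identityˡ _))
                                   (excess-weight a b (agreements ε j) (disagreements ε j) s b≤a Q+s<P))

    excess⁻-weight : ∀ j ε → length ε ≡ M →
                     excess⁻ j ε * ((a * b) ^ pairs M j * a ^ suc s) ≤ Weight.weight B A j ε * b ^ suc s
    excess⁻-weight j ε len with agreements ε j + s <? disagreements ε j
    ... | no  _     = z≤n
    ... | yes P+s<Q = subst (λ L → 1 * ((a * b) ^ L * a ^ suc s) ≤ Weight.weight B A j ε * b ^ suc s)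
                            (trans (+-comm (disagreements ε j) (agreements ε j))
                                   (trans (agreements+disagreements ε j) (cong (λ l → pairs l j) len)))
                            (subst₂ _≤_ (sym (*-identityˡ _))
                                        (cong (_* b ^ suc s) (*-comm (A ^ disagreements ε j) (B ^ agreements ε j)))
                                        (excess-weight a b (disagreements ε j) (agreements ε j) s b≤a P+s<Q))

    few-excesses-at : ∀ j → (∑ (excess⁺ j) V + ∑ (excess⁻ j) V) * (2 * M) < 2 ^ M
    few-excesses-at j = *-cancelʳ-< 2 _ _ (begin-strict
      (c⁺ + c⁻) * (2 * M) * 2         ≡⟨ ring c⁺ c⁻ M ⟩
      c⁺ * (4 * M) + c⁻ * (4 * M)     <⟨ +-mono-< (few-excesses A B (excess⁺ j) j refl (excess⁺-weight j))
                                                 (few-excesses B A (excess⁻ j) j (+-comm B A) (excess⁻-weight j)) ⟩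
      2 ^ M + 2 ^ M                   ≡⟨ ring′ (2 ^ M) ⟩
      2 ^ M * 2                       ∎)
      where
      open ≤-Reasoning
      c⁺ = ∑ (excess⁺ j) V
      c⁻ = ∑ (excess⁻ j) V
      ring : ∀ p q M → (p + q) * (2 * M) * 2 ≡ p * (4 * M) + q * (4 * M)
      ring = solve-∀
      ring′ : ∀ z → z + z ≡ z * 2
      ring′ = solve-∀

    badness : List Bool → ℕ
    badness ε = ∑ (λ j → excess⁺ j ε + excess⁻ j ε) (upTo (2 * M))

    ∑badness<length : ∑ badness V < length V
    ∑badness<length = *-cancelʳ-< (2 * M) _ _ (begin-strict
      ∑ badness V * (2 * M)                            ≡⟨ cong (_* (2 * M)) (∑-comm (λ ε j → excess⁺ j ε + excess⁻ j ε) V (upTo (2 * M))) ⟩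
      ∑ (λ j → ∑ (λ ε → excess⁺ j ε + excess⁻ j ε) V) (upTo (2 * M)) * (2 * M)
                                                       ≡⟨ cong (_* (2 * M)) (∑-cong {F = λ j → ∑ (λ ε → excess⁺ j ε + excess⁻ j ε) V}
                                                                       (All.universal (λ j → ∑-+ (excess⁺ j) (excess⁻ j) V) (upTo (2 * M)))) ⟩
      ∑ (λ j → ∑ (excess⁺ j) V + ∑ (excess⁻ j) V) (upTo (2 * M)) * (2 * M)
                                                       <⟨ ∑*<length* _ (2 * M) (2 ^ M) (upTo (2 * M)) 0<length few-excesses-at ⟩
      length (upTo (2 * M)) * 2 ^ M                    ≡⟨ cong (_* 2 ^ M) (length-upTo (2 * M)) ⟩
      2 * M * 2 ^ M                                    ≡⟨ cong (2 * M *_) (length-signVectors M) ⟨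
      2 * M * length V                                 ≡⟨ *-comm (2 * M) (length V) ⟩
      length V * (2 * M)                               ∎)
      where
      open ≤-Reasoning
      0<length : 0 < length (upTo (2 * M))
      0<length = subst (0 <_) (sym (length-upTo (2 * M))) (*-monoʳ-< 2 0<M)

    balanced-exists : Σ (List Bool) (λ ε → length ε ≡ M × Balanced s ε)
    balanced-exists with pigeonhole badness V (signVectors-length M) ∑badness<length
    ... | ε , len , badness≡0 = ε , len , balanced
      where
      balanced : Balanced s ε
      balanced j with j <? 2 * M
      ... | yes j<2M = ≮⇒≥ (𝟙≡0⇒¬ (disagreements ε j + s <? agreements ε j) (m+n≡0⇒m≡0 (excess⁺ j ε) terms≡0))
                     , ≮⇒≥ (𝟙≡0⇒¬ (agreements ε j + s <? disagreements ε j) (m+n≡0⇒n≡0 (excess⁺ j ε) terms≡0))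
        where
        terms≡0 : excess⁺ j ε + excess⁻ j ε ≡ 0
        terms≡0 = All.lookup (∑≡0 (upTo (2 * M)) badness≡0) (∈-upTo⁺ j<2M)
      ... | no j≮2M = subst (_≤ disagreements ε j + s) (sym P≡0) z≤n , subst (_≤ agreements ε j + s) (sym Q≡0) z≤n
        where
        P+Q≡0 : agreements ε j + disagreements ε j ≡ 0
        P+Q≡0 = trans (agreements+disagreements ε j) (trans (cong (λ l → pairs l j) len) (pairs-≥ M j (≮⇒≥ j≮2M)))
        P≡0 : agreements ε j ≡ 0
        P≡0 = m+n≡0⇒m≡0 (agreements ε j) P+Q≡0
        Q≡0 : disagreements ε j ≡ 0
        Q≡0 = m+n≡0⇒n≡0 (agreements ε j) P+Q≡0

module ExponentialBounds where

  open import Data.Nat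
  open import Data.Nat.Properties
  open import Data.Nat.Tactic.RingSolver using (solve-∀)
  open import Data.Product using (Σ; _,_)
  open import Data.Sum using (_⊎_; inj₁; inj₂)
  open import Relation.Binary.PropositionalEquality
  open import Defs using (expPartialScaled; ExpLe)
  open ≤-Reasoning

  bernoulli : ∀ r m → r ^ m * (r + m) ≤ r * suc r ^ m
  bernoulli r zero = ≤-reflexive (ring₀ r)
    where
    ring₀ : ∀ r → 1 * (r + 0) ≡ r * 1
    ring₀ = solve-∀
  bernoulli r (suc m) = begin
      r ^ suc m * (r + suc m)         ≡⟨ ring₁ r (r ^ m) m ⟩
      r ^ m * (r + m) * r + r ^ m * r  ≤⟨ +-monoʳ-≤ (r ^ m * (r + m) * r) (*-monoʳ-≤ (r ^ m) (m≤m+n r m)) ⟩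
      r ^ m * (r + m) * r + r ^ m * (r + m) ≡⟨ ring₂ (r ^ m * (r + m)) r ⟩
      r ^ m * (r + m) * suc r          ≤⟨ *-monoˡ-≤ (suc r) (bernoulli r m) ⟩
      r * suc r ^ m * suc r            ≡⟨ ring₃ r (suc r ^ m) (suc r) ⟩
      r * suc r ^ suc m ∎
    where
    ring₁ : ∀ r x m → r * x * (r + suc m) ≡ x * (r + m) * r + x * r
    ring₁ = solve-∀
    ring₂ : ∀ y r → y * r + y ≡ y * suc r
    ring₂ = solve-∀
    ring₃ : ∀ r x s → r * x * s ≡ r * (s * x)
    ring₃ = solve-∀

  2*r^r≤[1+r]^r : ∀ r → 1 ≤ r → 2 * r ^ r ≤ suc r ^ r
  2*r^r≤[1+r]^r r@(suc r₀) _ = *-cancelˡ-≤ r (begin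
      r * (2 * r ^ r) ≡⟨ ring r (r ^ r) ⟩
      r ^ r * (r + r) ≤⟨ bernoulli r r ⟩
      r * suc r ^ r ∎)
    where
    ring : ∀ r x → r * (2 * x) ≡ x * (r + r)
    ring = solve-∀

  [1+n]^m*q≤n^[1+m] : ∀ n m q → m + q ≡ n → suc n ^ m * q ≤ n ^ suc m
  [1+n]^m*q≤n^[1+m] n zero q refl = ≤-reflexive (ring₀ q)
    where
    ring₀ : ∀ q → 1 * q ≡ q * 1
    ring₀ = solve-∀
  [1+n]^m*q≤n^[1+m] n (suc m) q e = begin
      suc n ^ suc m * q          ≡⟨ ring₁ (suc n ^ m) n q ⟩
      suc n ^ m * (n * q + q)    ≤⟨ *-monoʳ-≤ (suc n ^ m) (+-monoʳ-≤ (n * q) q≤n) ⟩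
      suc n ^ m * (n * q + n)    ≡⟨ ring₂ (suc n ^ m) n q ⟩
      n * (suc n ^ m * suc q)    ≤⟨ *-monoʳ-≤ n ([1+n]^m*q≤n^[1+m] n m (suc q) (trans (+-suc m q) e)) ⟩
      n * n ^ suc m ∎
    where
    q≤n : q ≤ n
    q≤n = subst (q ≤_) e (≤-trans (n≤1+n q) (s≤s (m≤n+m q m)))
    ring₁ : ∀ x n q → (suc n * x) * q ≡ x * (n * q + q)
    ring₁ = solve-∀
    ring₂ : ∀ x n q → x * (n * q + n) ≡ n * (x * suc q)
    ring₂ = solve-∀

  -- (1 + 1/n)^(n/2) ≤ 2, by [1+n]^m*q≤n^[1+m] with m = q = n/2.
  [1+2m]^2m≤4*[2m]^2m : ∀ m → 1 ≤ m → suc (m + m) ^ (m + m) ≤ 4 * (m + m) ^ (m + m)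
  [1+2m]^2m≤4*[2m]^2m m@(suc m₀) _ = begin
      suc n ^ (m + m)             ≡⟨ ^-distribˡ-+-* (suc n) m m ⟩
      suc n ^ m * suc n ^ m       ≤⟨ *-mono-≤ h h ⟩
      (2 * n ^ m) * (2 * n ^ m)   ≡⟨ ring (n ^ m) ⟩
      4 * (n ^ m * n ^ m)         ≡⟨ cong (4 *_) (sym (^-distribˡ-+-* n m m)) ⟩
      4 * n ^ (m + m) ∎
    where
    n = m + m
    ring : ∀ x → (2 * x) * (2 * x) ≡ 4 * (x * x)
    ring = solve-∀
    h : suc n ^ m ≤ 2 * n ^ m
    h = *-cancelʳ-≤ (suc n ^ m) (2 * n ^ m) m (begin
          suc n ^ m * m  ≤⟨ [1+n]^m*q≤n^[1+m] n m m refl ⟩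
          n * n ^ m      ≡⟨ ring₂ m (n ^ m) ⟩
          2 * n ^ m * m ∎)
      where
      ring₂ : ∀ m x → (m + m) * x ≡ 2 * x * m
      ring₂ = solve-∀

  even-or-odd : ∀ n → Σ ℕ (λ m → (n ≡ m + m) ⊎ (n ≡ suc (m + m)))
  even-or-odd zero = 0 , inj₁ refl
  even-or-odd (suc n) with even-or-odd n
  ... | m , inj₁ e = m , inj₂ (cong suc e)
  ... | m , inj₂ e = suc m , inj₁ (trans (cong suc e) (cong suc (sym (+-suc m m))))

  [2+2m]^[1+2m]≤5*[1+2m]^[1+2m] : ∀ m → 1 ≤ m → suc (suc (m + m)) ^ suc (m + m) ≤ 5 * suc (m + m) ^ suc (m + m)
  [2+2m]^[1+2m]≤5*[1+2m]^[1+2m] m@(suc m₀) _ = *-cancelʳ-≤ (suc N ^ N) (5 * N ^ N) mm (begin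
      suc N ^ N * mm                            ≡⟨ cong (λ z → suc N ^ z * mm) (+-suc m m) ⟨
      suc N ^ (m + suc m) * mm                  ≡⟨ cong (_* mm) (^-distribˡ-+-* (suc N) m (suc m)) ⟩
      suc N ^ m * suc N ^ suc m * mm            ≡⟨ ring₁ (suc N ^ m) (suc N ^ suc m) m (suc m) ⟩
      (suc N ^ m * suc m) * (suc N ^ suc m * m) ≤⟨ *-mono-≤ ([1+n]^m*q≤n^[1+m] N m (suc m) (+-suc m m))
                                                            ([1+n]^m*q≤n^[1+m] N (suc m) m refl) ⟩
      N ^ suc m * N ^ suc (suc m)               ≡⟨ ring₂ N (N ^ m) ⟩
      N ^ m * N ^ suc m * (N * N)               ≡⟨ cong (_* (N * N)) (^-distribˡ-+-* N m (suc m)) ⟨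
      N ^ (m + suc m) * (N * N)                 ≡⟨ cong (λ z → N ^ z * (N * N)) (+-suc m m) ⟩
      N ^ N * (N * N)                           ≤⟨ *-monoʳ-≤ (N ^ N) N²≤5mm ⟩
      N ^ N * (5 * mm)                          ≡⟨ ring₃ (N ^ N) mm ⟩
      5 * N ^ N * mm                            ∎)
    where
    N = suc (m + m)
    mm = m * suc m
    N²≤5mm : N * N ≤ 5 * mm
    N²≤5mm = begin
      N * N                       ≡⟨ ring₀ m₀ ⟩
      4 * (m * suc m) + 1         ≤⟨ +-monoʳ-≤ (4 * (m * suc m)) (s≤s z≤n) ⟩
      4 * (m * suc m) + m * suc m ≡⟨ ring₀′ mm ⟩
      5 * mm                      ∎
      where
      ring₀ : ∀ m₀ → suc (suc m₀ + suc m₀) * suc (suc m₀ + suc m₀) ≡ 4 * (suc m₀ * suc (suc m₀)) + 1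
      ring₀ = solve-∀
      ring₀′ : ∀ x → 4 * x + x ≡ 5 * x
      ring₀′ = solve-∀
    ring₁ : ∀ a b m sm → a * b * (m * sm) ≡ (a * sm) * (b * m)
    ring₁ = solve-∀
    ring₂ : ∀ N x → (N * x) * (N * (N * x)) ≡ x * (N * x) * (N * N)
    ring₂ = solve-∀
    ring₃ : ∀ x y → x * (5 * y) ≡ 5 * x * y
    ring₃ = solve-∀

  [1+n]^n≤5*n^n : ∀ n → suc n ^ n ≤ 5 * n ^ n
  [1+n]^n≤5*n^n zero       = s≤s z≤n
  [1+n]^n≤5*n^n (suc zero) = s≤s (s≤s z≤n)
  [1+n]^n≤5*n^n n@(suc (suc n₀)) with even-or-odd n
  ... | zero  , inj₁ ()
  ... | zero  , inj₂ ()
  ... | m@(suc _) , inj₁ n≡2m   = subst (λ z → suc z ^ z ≤ 5 * z ^ z) (sym n≡2m)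
                                    (≤-trans ([1+2m]^2m≤4*[2m]^2m m (s≤s z≤n)) (*-monoˡ-≤ ((m + m) ^ (m + m)) (n≤1+n 4)))
  ... | m@(suc _) , inj₂ n≡1+2m = subst (λ z → suc z ^ z ≤ 5 * z ^ z) (sym n≡1+2m) ([2+2m]^[1+2m]≤5*[1+2m]^[1+2m] m (s≤s z≤n))

  [j+d]!≤j!*[j+d]^d : ∀ j d → (j + d) ! ≤ j ! * (j + d) ^ d
  [j+d]!≤j!*[j+d]^d j zero = ≤-reflexive (trans (cong _! (+-identityʳ j)) (sym (*-identityʳ (j !))))
  [j+d]!≤j!*[j+d]^d j (suc d) = begin
      (j + suc d) !                     ≡⟨ cong _! (+-suc j d) ⟩
      suc (j + d) * (j + d) !           ≤⟨ *-monoʳ-≤ (suc (j + d)) ([j+d]!≤j!*[j+d]^d j d) ⟩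
      suc (j + d) * (j ! * (j + d) ^ d) ≤⟨ *-monoʳ-≤ (suc (j + d)) (*-monoʳ-≤ (j !) (^-monoˡ-≤ d (n≤1+n (j + d)))) ⟩
      suc (j + d) * (j ! * suc (j + d) ^ d) ≡⟨ ring (suc (j + d)) (j !) (suc (j + d) ^ d) ⟩
      j ! * (suc (j + d) * suc (j + d) ^ d) ≡⟨ cong (λ z → j ! * z ^ suc d) (sym (+-suc j d)) ⟩
      j ! * (j + suc d) ^ suc d ∎
    where
    ring : ∀ a b c → a * (b * c) ≡ b * (a * c)
    ring = solve-∀

  a!*a^d≤[a+d]! : ∀ a d → a ! * a ^ d ≤ (a + d) !
  a!*a^d≤[a+d]! a zero = ≤-reflexive (trans (*-identityʳ (a !)) (cong _! (sym (+-identityʳ a))))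
  a!*a^d≤[a+d]! a (suc d) = begin
      a ! * a ^ suc d             ≡⟨ ring a (a !) (a ^ d) ⟩
      a * (a ! * a ^ d)           ≤⟨ *-mono-≤ (≤-trans (m≤m+n a d) (n≤1+n (a + d))) (a!*a^d≤[a+d]! a d) ⟩
      suc (a + d) * (a + d) !     ≡⟨ cong _! (sym (+-suc a d)) ⟩
      (a + suc d) ! ∎
    where
    ring : ∀ a f x → f * (a * x) ≡ a * (f * x)
    ring = solve-∀

  a^j*a!≤a^a*j! : ∀ a j → a ^ j * a ! ≤ a ^ a * j !
  a^j*a!≤a^a*j! a j with ≤-total j a
  ... | inj₁ j≤a with m≤n⇒∃[o]m+o≡n j≤a
  ...   | d , refl = begin
      (j + d) ^ j * (j + d) !               ≤⟨ *-monoʳ-≤ ((j + d) ^ j) ([j+d]!≤j!*[j+d]^d j d) ⟩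
      (j + d) ^ j * (j ! * (j + d) ^ d)     ≡⟨ ring ((j + d) ^ j) (j !) ((j + d) ^ d) ⟩
      ((j + d) ^ j * (j + d) ^ d) * j !     ≡⟨ cong (_* j !) (sym (^-distribˡ-+-* (j + d) j d)) ⟩
      (j + d) ^ (j + d) * j ! ∎
    where
    ring : ∀ x f y → x * (f * y) ≡ (x * y) * f
    ring = solve-∀
  a^j*a!≤a^a*j! a j | inj₂ a≤j with m≤n⇒∃[o]m+o≡n a≤j
  ...   | d , refl = begin
      a ^ (a + d) * a !         ≡⟨ cong (_* a !) (^-distribˡ-+-* a a d) ⟩
      a ^ a * a ^ d * a !       ≡⟨ ring (a ^ a) (a ^ d) (a !) ⟩
      a ^ a * (a ! * a ^ d)     ≤⟨ *-monoʳ-≤ (a ^ a) (a!*a^d≤[a+d]! a d) ⟩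
      a ^ a * (a + d) ! ∎
    where
    ring : ∀ x y f → x * y * f ≡ x * (f * y)
    ring = solve-∀

  a^a≤5^a*a! : ∀ a → a ^ a ≤ 5 ^ a * a !
  a^a≤5^a*a! zero = s≤s z≤n
  a^a≤5^a*a! (suc a) = begin
      suc a ^ suc a              ≡⟨ refl ⟩
      suc a * suc a ^ a          ≤⟨ *-monoʳ-≤ (suc a) ([1+n]^n≤5*n^n a) ⟩
      suc a * (5 * a ^ a)        ≤⟨ *-monoʳ-≤ (suc a) (*-monoʳ-≤ 5 (a^a≤5^a*a! a)) ⟩
      suc a * (5 * (5 ^ a * a !)) ≡⟨ ring (suc a) (5 ^ a) (a !) ⟩
      5 * 5 ^ a * (suc a * a !) ∎
    where
    ring : ∀ s p f → s * (5 * (p * f)) ≡ 5 * p * (s * f)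
    ring = solve-∀

  a^j≤5^a*j! : ∀ a j → a ^ j ≤ 5 ^ a * j !
  a^j≤5^a*j! a j = *-cancelʳ-≤ (a ^ j) (5 ^ a * j !) (a !) {{a !≢0}} (begin
      a ^ j * a !            ≤⟨ a^j*a!≤a^a*j! a j ⟩
      a ^ a * j !            ≤⟨ *-monoˡ-≤ (j !) (a^a≤5^a*a! a) ⟩
      5 ^ a * a ! * j !      ≡⟨ ring (5 ^ a) (a !) (j !) ⟩
      5 ^ a * j ! * a ! ∎)
    where
    ring : ∀ x y z → x * y * z ≡ x * z * y
    ring = solve-∀

  -- If a^j ≤ A j! for all j, each term a^j / j! of the series of e^a is at most A, and from
  -- j = 2a on consecutive terms at least halve; hence e^a ≤ (2a + 2) A.
  module PowerBound (a A : ℕ) (hA : ∀ j → a ^ j ≤ A * j !) where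
    S : ℕ → ℕ
    S = expPartialScaled a

    S≤ : ∀ k → S k ≤ suc k * A * k !
    S≤ zero = ≤-trans (hA 0) (≤-reflexive (ring₀ A))
      where
      ring₀ : ∀ A → A * 1 ≡ 1 * A * 1
      ring₀ = solve-∀
    S≤ (suc k) = begin
      suc k * S k + a ^ suc k                 ≤⟨ +-mono-≤ (*-monoʳ-≤ (suc k) (S≤ k)) (hA (suc k)) ⟩
      suc k * (suc k * A * k !) + A * (suc k * k !) ≡⟨ ring (suc k) A (k !) ⟩
      suc (suc k) * A * (suc k * k !) ∎
      where
      ring : ∀ s A f → s * (s * A * f) + A * (s * f) ≡ (1 + s) * A * (s * f)
      ring = solve-∀

    S+a^≤ : ∀ d → S (2 * a + d) + a ^ (2 * a + d) ≤ (2 * a + 2) * A * (2 * a + d) !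
    S+a^≤ zero = begin
        S (2 * a + 0) + a ^ (2 * a + 0) ≤⟨ +-mono-≤ (S≤ (2 * a + 0)) (hA (2 * a + 0)) ⟩
        suc k * A * k ! + A * k ! ≡⟨ ring k A (k !) ⟩
        (k + 2) * A * k ! ≡⟨ cong (λ z → (z + 2) * A * k !) (+-identityʳ (2 * a)) ⟩
        (2 * a + 2) * A * k ! ∎
      where
      k = 2 * a + 0
      ring : ∀ k A f → suc k * A * f + A * f ≡ (k + 2) * A * f
      ring = solve-∀
    S+a^≤ (suc d) = subst (λ z → S z + a ^ z ≤ (2 * a + 2) * A * z !) (sym (+-suc (2 * a) d)) (begin
        suc k * S k + a ^ suc k + a ^ suc k ≡⟨ ring₁ (suc k) (S k) a (a ^ k) ⟩
        suc k * S k + (2 * a) * a ^ k       ≤⟨ +-monoʳ-≤ (suc k * S k) (*-monoˡ-≤ (a ^ k) (≤-trans (m≤m+n (2 * a) d) (n≤1+n k))) ⟩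
        suc k * S k + suc k * a ^ k         ≡⟨ sym (*-distribˡ-+ (suc k) (S k) (a ^ k)) ⟩
        suc k * (S k + a ^ k)               ≤⟨ *-monoʳ-≤ (suc k) (S+a^≤ d) ⟩
        suc k * ((2 * a + 2) * A * k !)     ≡⟨ ring₂ (suc k) (2 * a + 2) A (k !) ⟩
        (2 * a + 2) * A * (suc k * k !) ∎)
      where
      k = 2 * a + d
      ring₁ : ∀ s S a x → s * S + a * x + a * x ≡ s * S + (2 * a) * x
      ring₁ = solve-∀
      ring₂ : ∀ s c A f → s * (c * A * f) ≡ c * A * (s * f)
      ring₂ = solve-∀

    expLe : ExpLe a ((2 * a + 2) * A)
    expLe k with ≤-total k (2 * a)
    ... | inj₁ k≤ = ≤-trans (S≤ k) (*-monoˡ-≤ (k !) (*-monoˡ-≤ A (≤-trans (s≤s k≤) (≤-trans (n≤1+n _) (≤-reflexive (+-comm 2 (2 * a)))))))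
    ... | inj₂ ge with m≤n⇒∃[o]m+o≡n ge
    ...   | d , refl = ≤-trans (m≤m+n (S (2 * a + d)) _) (S+a^≤ d)

  ExpLe-5^ : ∀ a → ExpLe a ((2 * a + 2) * 5 ^ a)
  ExpLe-5^ a = PowerBound.expLe a (5 ^ a) (a^j≤5^a*j! a)

  expPartialScaled-mono : ∀ a a′ k → a ≤ a′ → expPartialScaled a k ≤ expPartialScaled a′ k
  expPartialScaled-mono a a′ zero    a≤a′ = ≤-refl
  expPartialScaled-mono a a′ (suc k) a≤a′ = +-mono-≤ (*-monoʳ-≤ (suc k) (expPartialScaled-mono a a′ k a≤a′)) (^-monoˡ-≤ (suc k) a≤a′)

  ExpLe-mono : ∀ a a′ Y Y′ → a ≤ a′ → Y ≤ Y′ → ExpLe a′ Y → ExpLe a Y′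
  ExpLe-mono a a′ Y Y′ a≤a′ Y≤Y′ e^a′≤Y k = ≤-trans (expPartialScaled-mono a a′ k a≤a′) (≤-trans (e^a′≤Y k) (*-monoˡ-≤ (k !) Y≤Y′))



module Parameters where

  open import Data.Nat as ℕ using (ℕ; zero; suc; _∸_; z≤n; s≤s; _+_; _*_; _^_; _≤_; _<_; _≤?_)
  open import Data.Nat.Properties
  open import Data.Nat.Tactic.RingSolver using (solve-∀)
  open import Data.Product using (Σ; _×_; _,_; proj₁; proj₂)
  open import Data.Sum using (inj₁; inj₂)
  open import Data.Empty using (⊥-elim)
  open import Relation.Nullary using (Dec; yes; no; ¬_)
  open import Relation.Binary.PropositionalEquality
  open ≤-Reasoning
  open import Defs using (ExpLe)
  open Chernoff using (^-distribʳ-*)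
  open ExponentialBounds

  Minimal : (ℕ → Set) → Set
  Minimal P = Σ ℕ (λ x → P x × (∀ y → y < x → ¬ P y))

  minimal : (P : ℕ → Set) → (∀ n → Dec (P n)) → ∀ B → P B → Minimal P
  minimal P P? B pB = search B 0 refl (λ y ())
    where
    search : ∀ k i → i + k ≡ B → (∀ y → y < i → ¬ P y) → Minimal P
    search k i i+k≡B below-i with P? i
    ... | yes pi = i , pi , below-i
    search zero    i i+k≡B below-i | no ¬pi = ⊥-elim (¬pi (subst P (trans (sym i+k≡B) (+-identityʳ i)) pB))
    search (suc k) i i+k≡B below-i | no ¬pi = search k (suc i) (trans (sym (+-suc i k)) i+k≡B) below-1+i
      where
      below-1+i : ∀ y → y < suc i → ¬ P y
      below-1+i y y<1+i with m<1+n⇒m<n∨m≡n y<1+i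
      ... | inj₁ y<i  = below-i y y<i
      ... | inj₂ refl = ¬pi

  n<2^n : ∀ n → n < 2 ^ n
  n<2^n zero    = s≤s z≤n
  n<2^n (suc n) = begin-strict
    suc n         <⟨ s≤s (n<2^n n) ⟩
    suc (2 ^ n)   ≤⟨ +-monoˡ-≤ (2 ^ n) (m^n>0 2 n) ⟩
    2 ^ n + 2 ^ n ≡⟨ cong (2 ^ n +_) (+-identityʳ (2 ^ n)) ⟨
    2 * 2 ^ n     ∎

  [1+x]^L*x^M≤[1+x]^M*x^L : ∀ x L M → L ≤ M → suc x ^ L * x ^ M ≤ suc x ^ M * x ^ L
  [1+x]^L*x^M≤[1+x]^M*x^L x L M L≤M with m≤n⇒∃[o]m+o≡n L≤M
  ... | k , refl = begin
    suc x ^ L * x ^ (L + k)             ≡⟨ cong (suc x ^ L *_) (^-distribˡ-+-* x L k) ⟩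
    suc x ^ L * (x ^ L * x ^ k)         ≤⟨ *-monoʳ-≤ (suc x ^ L) (*-monoʳ-≤ (x ^ L) (^-monoˡ-≤ k (n≤1+n x))) ⟩
    suc x ^ L * (x ^ L * suc x ^ k)     ≡⟨ ring (suc x ^ L) (x ^ L) (suc x ^ k) ⟩
    (suc x ^ L * suc x ^ k) * x ^ L     ≡⟨ cong (_* x ^ L) (^-distribˡ-+-* (suc x) L k) ⟨
    suc x ^ (L + k) * x ^ L             ∎
    where
    ring : ∀ a b c → a * (b * c) ≡ (a * c) * b
    ring = solve-∀

  -- ℓ = ⌈log₂ M⌉ and r is the least number with M ≤ 2r(r + 1)ℓ, so that r²ℓ ≈ M/2.
  module Choice (M : ℕ) (64≤M : 64 ≤ M) where

    ℓ-search : Minimal (λ l → M ≤ 2 ^ l)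
    ℓ-search = minimal (λ l → M ≤ 2 ^ l) (λ l → M ≤? 2 ^ l) M (<⇒≤ (n<2^n M))

    ℓ : ℕ
    ℓ = proj₁ ℓ-search

    M≤2^ℓ : M ≤ 2 ^ ℓ
    M≤2^ℓ = proj₁ (proj₂ ℓ-search)

    ℓ-minimal : ∀ y → y < ℓ → ¬ (M ≤ 2 ^ y)
    ℓ-minimal = proj₂ (proj₂ ℓ-search)

    1≤M : 1 ≤ M
    1≤M = ≤-trans (s≤s z≤n) 64≤M

    1≤ℓ : 1 ≤ ℓ
    1≤ℓ with ℓ in eq
    ... | zero = ⊥-elim (<⇒≱ (≤-trans (s≤s (s≤s z≤n)) 64≤M) (subst (λ z → M ≤ 2 ^ z) eq M≤2^ℓ))
    ... | suc _ = s≤s z≤n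

    ℓ′ : ℕ
    ℓ′ = ℓ ∸ 1
    ℓ≡1+ℓ′ : ℓ ≡ suc ℓ′
    ℓ≡1+ℓ′ = sym (m+[n∸m]≡n 1≤ℓ)

    2^ℓ′<M : 2 ^ ℓ′ < M
    2^ℓ′<M = ≰⇒> (ℓ-minimal ℓ′ (subst (ℓ′ <_) (sym ℓ≡1+ℓ′) ≤-refl))

    2^ℓ≤2M : 2 ^ ℓ ≤ 2 * M
    2^ℓ≤2M = subst (λ z → 2 ^ z ≤ 2 * M) (sym ℓ≡1+ℓ′) (*-monoʳ-≤ 2 (<⇒≤ 2^ℓ′<M))

    ℓ≤M : ℓ ≤ M
    ℓ≤M = subst (_≤ M) (sym ℓ≡1+ℓ′) (<-trans (n<2^n ℓ′) 2^ℓ′<M)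

    r-search : Minimal (λ r → M ≤ 2 * (r * suc r) * ℓ)
    r-search = minimal (λ r → M ≤ 2 * (r * suc r) * ℓ) (λ r → M ≤? 2 * (r * suc r) * ℓ) M
      (≤-trans (m≤m*n M (suc M)) (≤-trans (m≤n*m (M * suc M) 2) (m≤m*n (2 * (M * suc M)) ℓ {{ℕ.>-nonZero 1≤ℓ}})))

    r : ℕ
    r = proj₁ r-search

    M≤2r[1+r]ℓ : M ≤ 2 * (r * suc r) * ℓ
    M≤2r[1+r]ℓ = proj₁ (proj₂ r-search)

    r-minimal : ∀ y → y < r → ¬ (M ≤ 2 * (y * suc y) * ℓ)
    r-minimal = proj₂ (proj₂ r-search)

    1≤r : 1 ≤ r
    1≤r with r in eq
    ... | zero = ⊥-elim (<⇒≱ (≤-trans (s≤s z≤n) 64≤M) (subst (λ z → M ≤ 2 * (z * suc z) * ℓ) eq M≤2r[1+r]ℓ))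
    ... | suc _ = s≤s z≤n

    r*r*ℓ≤M : r * r * ℓ ≤ M
    r*r*ℓ≤M with r in r≡
    ... | zero          = ⊥-elim (<⇒≱ (≤-trans (s≤s z≤n) 64≤M) (subst (λ z → M ≤ 2 * (z * suc z) * ℓ) r≡ M≤2r[1+r]ℓ))
    ... | suc zero      = subst (_≤ M) (sym (+-identityʳ ℓ)) ℓ≤M
    ... | suc (suc r₀) = ≤-trans (*-monoˡ-≤ ℓ square≤) (<⇒≤ (≰⇒> (r-minimal (suc r₀) (subst (suc r₀ <_) (sym r≡) ≤-refl))))
      where
      square≤ : suc (suc r₀) * suc (suc r₀) ≤ 2 * (suc r₀ * suc (suc r₀))
      square≤ = ≤-trans (*-monoˡ-≤ (suc (suc r₀)) (s≤s (m≤n+m (suc r₀) r₀)))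
                        (≤-reflexive (trans (cong (λ z → (suc r₀ + z) * suc (suc r₀)) (sym (+-identityʳ (suc r₀))))
                                            (*-assoc 2 (suc r₀) (suc (suc r₀)))))

    t : ℕ
    t = 3 * ℓ + 3

    1≤rt : 1 ≤ r * t
    1≤rt = *-mono-≤ 1≤r (≤-trans (s≤s z≤n) (m≤n+m 3 (3 * ℓ)))

    s : ℕ
    s = r * t ∸ 1

    1+s≡rt : suc s ≡ r * t
    1+s≡rt = trans (+-comm 1 s) (m∸n+n≡m 1≤rt)

    a b n : ℕ
    a = suc r
    b = r
    n = 2 * (r * suc r)

    1≤n : 1 ≤ n
    1≤n = *-mono-≤ (s≤s {0} {1} z≤n) (*-mono-≤ 1≤r (s≤s z≤n))

    [1+n]^nℓ≤4^ℓ*n^nℓ : suc n ^ (n * ℓ) ≤ 4 ^ ℓ * n ^ (n * ℓ)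
    [1+n]^nℓ≤4^ℓ*n^nℓ = begin
      suc n ^ (n * ℓ)          ≡⟨ ^-*-assoc (suc n) n ℓ ⟨
      (suc n ^ n) ^ ℓ          ≤⟨ ^-monoˡ-≤ ℓ [1+n]^n≤4*n^n ⟩
      (4 * n ^ n) ^ ℓ          ≡⟨ ^-distribʳ-* 4 (n ^ n) ℓ ⟩
      4 ^ ℓ * (n ^ n) ^ ℓ      ≡⟨ cong (4 ^ ℓ *_) (^-*-assoc n n ℓ) ⟩
      4 ^ ℓ * n ^ (n * ℓ)      ∎
      where
      m = r * suc r
      [1+n]^n≤4*n^n : suc n ^ n ≤ 4 * n ^ n
      [1+n]^n≤4*n^n = subst (λ z → suc z ^ z ≤ 4 * z ^ z) (cong (m +_) (sym (+-identityʳ m)))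
                            ([1+2m]^2m≤4*[2m]^2m m (*-mono-≤ 1≤r (s≤s z≤n)))

    4M*4^ℓ<2^t : 4 * M * 4 ^ ℓ < 2 ^ t
    4M*4^ℓ<2^t = begin-strict
      4 * M * 4 ^ ℓ            ≤⟨ *-monoˡ-≤ (4 ^ ℓ) (*-monoʳ-≤ 4 M≤2^ℓ) ⟩
      4 * x * 4 ^ ℓ            ≡⟨ cong (4 * x *_) (^-distribʳ-* 2 2 ℓ) ⟩
      4 * x * (x * x)          <⟨ *-monoˡ-< (x * x) {{ℕ.>-nonZero (*-mono-≤ 1≤x 1≤x)}} (*-monoˡ-< x {{ℕ.>-nonZero 1≤x}} (m<m+n 4 {4} (s≤s z≤n))) ⟩
      8 * x * (x * x)          ≡⟨ ring x ⟩
      x ^ 3 * 8                ≡⟨ cong (_* 8) (^-*-assoc 2 ℓ 3) ⟩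
      2 ^ (ℓ * 3) * 2 ^ 3      ≡⟨ cong (λ e → 2 ^ e * 2 ^ 3) (*-comm ℓ 3) ⟩
      2 ^ (3 * ℓ) * 2 ^ 3      ≡⟨ ^-distribˡ-+-* 2 (3 * ℓ) 3 ⟨
      2 ^ (3 * ℓ + 3)          ∎
      where
      x = 2 ^ ℓ
      1≤x : 1 ≤ x
      1≤x = m^n>0 2 ℓ
      ring : ∀ x → 8 * x * (x * x) ≡ x * (x * (x * 1)) * 8
      ring = solve-∀

    2^t*r^rt≤[1+r]^rt : 2 ^ t * r ^ (r * t) ≤ suc r ^ (r * t)
    2^t*r^rt≤[1+r]^rt = begin
      2 ^ t * r ^ (r * t)      ≡⟨ cong (2 ^ t *_) (^-*-assoc r r t) ⟨
      2 ^ t * (r ^ r) ^ t      ≡⟨ ^-distribʳ-* 2 (r ^ r) t ⟨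
      (2 * r ^ r) ^ t          ≤⟨ ^-monoˡ-≤ t (2*r^r≤[1+r]^r r 1≤r) ⟩
      (suc r ^ r) ^ t          ≡⟨ ^-*-assoc (suc r) r t ⟩
      suc r ^ (r * t)          ∎

    tail-small : ∀ L → L ≤ M → 4 * M * (b ^ suc s * (a * a + b * b) ^ L) < 2 ^ L * ((a * b) ^ L * a ^ suc s)
    tail-small L L≤M =
      subst₂ (λ u v → 4 * M * (r ^ u * v ^ L) < 2 ^ L * ((suc r * r) ^ L * suc r ^ u)) (sym 1+s≡rt) (ring₀ r)
             (subst (4 * M * (R * suc n ^ L) <_) (sym 2^L*[ab]^L≡n^L) (*-cancelʳ-< Z _ _ (begin-strict
        4 * M * (R * suc n ^ L) * (n ^ M * n ^ (n * ℓ))       ≡⟨ ring₁ (4 * M) R (suc n ^ L) (n ^ M) (n ^ (n * ℓ)) ⟩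
        4 * M * R * (suc n ^ L * n ^ M) * n ^ (n * ℓ)         ≤⟨ *-monoˡ-≤ (n ^ (n * ℓ)) (*-monoʳ-≤ (4 * M * R)
                                                                   ([1+x]^L*x^M≤[1+x]^M*x^L n L M L≤M)) ⟩
        4 * M * R * (suc n ^ M * n ^ L) * n ^ (n * ℓ)         ≡⟨ ring₂ (4 * M * R) (suc n ^ M) (n ^ L) (n ^ (n * ℓ)) ⟩
        4 * M * R * n ^ L * (suc n ^ M * n ^ (n * ℓ))         ≤⟨ *-monoʳ-≤ (4 * M * R * n ^ L) ([1+x]^L*x^M≤[1+x]^M*x^L n M (n * ℓ) M≤2r[1+r]ℓ) ⟩
        4 * M * R * n ^ L * (suc n ^ (n * ℓ) * n ^ M)         ≤⟨ *-monoʳ-≤ (4 * M * R * n ^ L) (*-monoˡ-≤ (n ^ M) [1+n]^nℓ≤4^ℓ*n^nℓ) ⟩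
        4 * M * R * n ^ L * (4 ^ ℓ * n ^ (n * ℓ) * n ^ M)     ≡⟨ ring₃ (4 * M) R (n ^ L) (4 ^ ℓ) (n ^ (n * ℓ)) (n ^ M) ⟩
        (4 * M * 4 ^ ℓ) * (R * W)                             <⟨ *-monoˡ-< (R * W) {{ℕ.>-nonZero 1≤RW}} 4M*4^ℓ<2^t ⟩
        2 ^ t * (R * W)                                       ≡⟨ *-assoc (2 ^ t) R W ⟨
        (2 ^ t * R) * W                                       ≤⟨ *-monoˡ-≤ W 2^t*r^rt≤[1+r]^rt ⟩
        suc r ^ (r * t) * W                                   ≡⟨ ring₄ (suc r ^ (r * t)) (n ^ L) (n ^ (n * ℓ)) (n ^ M) ⟩
        n ^ L * suc r ^ (r * t) * (n ^ M * n ^ (n * ℓ))       ∎)))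
      where
      R = r ^ (r * t)
      W = n ^ L * n ^ (n * ℓ) * n ^ M
      Z = n ^ M * n ^ (n * ℓ)
      1≤RW : 1 ≤ R * W
      1≤RW = *-mono-≤ (m^n>0 r {{ℕ.>-nonZero 1≤r}} (r * t)) (*-mono-≤ (*-mono-≤ (1≤n^ L) (1≤n^ (n * ℓ))) (1≤n^ M))
        where
        1≤n^ : ∀ k → 1 ≤ n ^ k
        1≤n^ = m^n>0 n {{ℕ.>-nonZero 1≤n}}
      2^L*[ab]^L≡n^L : 2 ^ L * ((suc r * r) ^ L * suc r ^ (r * t)) ≡ n ^ L * suc r ^ (r * t)
      2^L*[ab]^L≡n^L = trans (sym (*-assoc (2 ^ L) _ _)) (cong (_* suc r ^ (r * t))
                         (trans (sym (^-distribʳ-* 2 (suc r * r) L)) (cong (λ z → (2 * z) ^ L) (*-comm (suc r) r))))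
      ring₀ : ∀ r → suc (2 * (r * suc r)) ≡ suc r * suc r + r * r
      ring₀ = solve-∀
      ring₁ : ∀ c R s m k → c * (R * s) * (m * k) ≡ c * R * (s * m) * k
      ring₁ = solve-∀
      ring₂ : ∀ c x y k → c * (x * y) * k ≡ c * y * (x * k)
      ring₂ = solve-∀
      ring₃ : ∀ c R y f k m → c * R * y * (f * k * m) ≡ (c * f) * (R * (y * k * m))
      ring₃ = solve-∀
      ring₄ : ∀ A y k m → A * (y * k * m) ≡ y * A * (m * k)
      ring₄ = solve-∀

    expBound : ℕ → ℕ
    expBound x = (2 * x + 2) * 5 ^ x

    expBound-mono : ∀ {x y} → x ≤ y → expBound x ≤ expBound y
    expBound-mono x≤y = *-mono-≤ (+-monoˡ-≤ 2 (*-monoʳ-≤ 2 x≤y)) (^-monoʳ-≤ 5 x≤y)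

    a₁ : ℕ
    a₁ = 36 * M * (ℓ + 3)

    [2rt]²≤a₁ : 2 * (r * t) * (2 * (r * t)) ≤ a₁
    [2rt]²≤a₁ = begin
      2 * (r * t) * (2 * (r * t))         ≡⟨ ring₁ r ℓ ⟩
      36 * (r * r) * ((ℓ + 1) * (ℓ + 1))  ≤⟨ *-monoʳ-≤ (36 * (r * r)) [ℓ+1]²≤ℓ[ℓ+3] ⟩
      36 * (r * r) * (ℓ * (ℓ + 3))        ≡⟨ ring₂ r ℓ ⟩
      36 * (r * r * ℓ) * (ℓ + 3)          ≤⟨ *-monoˡ-≤ (ℓ + 3) (*-monoʳ-≤ 36 r*r*ℓ≤M) ⟩
      36 * M * (ℓ + 3)                    ∎
      where
      ring₁ : ∀ r l → 2 * (r * (3 * l + 3)) * (2 * (r * (3 * l + 3))) ≡ 36 * (r * r) * ((l + 1) * (l + 1))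
      ring₁ = solve-∀
      ring₂ : ∀ r l → 36 * (r * r) * (l * (l + 3)) ≡ 36 * (r * r * l) * (l + 3)
      ring₂ = solve-∀
      [ℓ+1]²≤ℓ[ℓ+3] : (ℓ + 1) * (ℓ + 1) ≤ ℓ * (ℓ + 3)
      [ℓ+1]²≤ℓ[ℓ+3] = begin
        (ℓ + 1) * (ℓ + 1)     ≡⟨ ring₃ ℓ ⟩
        ℓ * ℓ + 2 * ℓ + 1     ≤⟨ +-monoʳ-≤ (ℓ * ℓ + 2 * ℓ) 1≤ℓ ⟩
        ℓ * ℓ + 2 * ℓ + ℓ     ≡⟨ ring₄ ℓ ⟩
        ℓ * (ℓ + 3)           ∎
        where
        ring₃ : ∀ l → (l + 1) * (l + 1) ≡ l * l + 2 * l + 1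
        ring₃ = solve-∀
        ring₄ : ∀ l → l * l + 2 * l + l ≡ l * (l + 3)
        ring₄ = solve-∀

    2a₁+2≤[16M]^3 : 2 * a₁ + 2 ≤ (16 * M) ^ 3
    2a₁+2≤[16M]^3 = begin
      2 * (36 * M * (ℓ + 3)) + 2       ≤⟨ +-monoˡ-≤ 2 (*-monoʳ-≤ 2 (*-monoʳ-≤ (36 * M) ℓ+3≤4M)) ⟩
      2 * (36 * M * (4 * M)) + 2       ≡⟨ ring₁ M ⟩
      288 * (M * M) + 2                ≤⟨ +-mono-≤ (*-monoʳ-≤ 288 (m≤m*n (M * M) M {{ℕ.>-nonZero 1≤M}})) (*-monoʳ-≤ 2 1≤M³) ⟩
      288 * M³ + 2 * M³                ≤⟨ +-monoʳ-≤ (288 * M³) (*-monoˡ-≤ M³ (m≤m+n 2 3806)) ⟩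
      288 * M³ + 3808 * M³             ≡⟨ ring₂ M ⟩
      (16 * M) ^ 3                     ∎
      where
      M³ = M * M * M
      1≤M³ : 1 ≤ M³
      1≤M³ = *-mono-≤ (*-mono-≤ {1} {M} {1} 1≤M 1≤M) 1≤M
      ℓ+3≤4M : ℓ + 3 ≤ 4 * M
      ℓ+3≤4M = ≤-trans (+-mono-≤ ℓ≤M (*-monoʳ-≤ 3 1≤M)) (≤-reflexive (ring₀ M))
        where
        ring₀ : ∀ M → M + 3 * M ≡ 4 * M
        ring₀ = solve-∀
      ring₁ : ∀ M → 2 * (36 * M * (4 * M)) + 2 ≡ 288 * (M * M) + 2
      ring₁ = solve-∀
      ring₂ : ∀ M → 288 * (M * M * M) + 3808 * (M * M * M) ≡ 16 * M * (16 * M * (16 * M * 1))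
      ring₂ = solve-∀

    5^a₁≤[16M]^84M : 5 ^ a₁ ≤ (16 * M) ^ (84 * M)
    5^a₁≤[16M]^84M = begin
      5 ^ a₁                       ≡⟨ cong (5 ^_) (ring₁ M ℓ) ⟩
      5 ^ (3 * e)                  ≡⟨ ^-*-assoc 5 3 e ⟨
      125 ^ e                      ≤⟨ ^-monoˡ-≤ e (m≤m+n 125 3) ⟩
      (2 ^ 7) ^ e                  ≡⟨ ^-*-assoc 2 7 e ⟩
      2 ^ (7 * e)                  ≡⟨ cong (2 ^_) (ring₂ M ℓ) ⟩
      2 ^ ((ℓ + 3) * (84 * M))     ≡⟨ ^-*-assoc 2 (ℓ + 3) (84 * M) ⟨
      (2 ^ (ℓ + 3)) ^ (84 * M)     ≤⟨ ^-monoˡ-≤ (84 * M) 2^[ℓ+3]≤16M ⟩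
      (16 * M) ^ (84 * M)          ∎
      where
      e = 12 * M * (ℓ + 3)
      ring₁ : ∀ M l → 36 * M * (l + 3) ≡ 3 * (12 * M * (l + 3))
      ring₁ = solve-∀
      ring₂ : ∀ M l → 7 * (12 * M * (l + 3)) ≡ (l + 3) * (84 * M)
      ring₂ = solve-∀
      2^[ℓ+3]≤16M : 2 ^ (ℓ + 3) ≤ 16 * M
      2^[ℓ+3]≤16M = begin
        2 ^ (ℓ + 3)  ≡⟨ ^-distribˡ-+-* 2 ℓ 3 ⟩
        2 ^ ℓ * 8    ≤⟨ *-monoˡ-≤ 8 2^ℓ≤2M ⟩
        2 * M * 8    ≡⟨ ring₃ M ⟩
        16 * M       ∎
        where
        ring₃ : ∀ M → 2 * M * 8 ≡ 16 * M
        ring₃ = solve-∀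

    expBound-a₁≤M^144M : expBound a₁ ≤ M ^ (144 * M)
    expBound-a₁≤M^144M = begin
      (2 * a₁ + 2) * 5 ^ a₁        ≤⟨ *-mono-≤ 2a₁+2≤[16M]^3 5^a₁≤[16M]^84M ⟩
      X ^ 3 * X ^ (84 * M)         ≡⟨ ^-distribˡ-+-* X 3 (84 * M) ⟨
      X ^ (3 + 84 * M)             ≤⟨ ^-monoʳ-≤ X {{ℕ.>-nonZero (*-mono-≤ {1} {16} (s≤s z≤n) 1≤M)}} 3+84M≤85M ⟩
      X ^ (85 * M)                 ≡⟨ ^-*-assoc X 85 M ⟨
      (X ^ 85) ^ M                 ≤⟨ ^-monoˡ-≤ M X^85≤M^144 ⟩
      (M ^ 144) ^ M                ≡⟨ ^-*-assoc M 144 M ⟩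
      M ^ (144 * M)                ∎
      where
      X = 16 * M
      3+84M≤85M : 3 + 84 * M ≤ 85 * M
      3+84M≤85M = ≤-trans (+-monoˡ-≤ (84 * M) (≤-trans (m≤m+n 3 61) 64≤M)) (≤-reflexive (ring M))
        where
        ring : ∀ M → M + 84 * M ≡ 85 * M
        ring = solve-∀
      X^85≤M^144 : X ^ 85 ≤ M ^ 144
      X^85≤M^144 = begin
        (16 * M) ^ 85        ≡⟨ ^-distribʳ-* 16 M 85 ⟩
        16 ^ 85 * M ^ 85     ≡⟨ cong (_* M ^ 85) (^-*-assoc 2 4 85) ⟩
        2 ^ 340 * M ^ 85     ≤⟨ *-monoˡ-≤ (M ^ 85) (^-monoʳ-≤ 2 (m≤m+n 340 14)) ⟩
        2 ^ 354 * M ^ 85     ≡⟨ cong (_* M ^ 85) (^-*-assoc 2 6 59) ⟨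
        64 ^ 59 * M ^ 85     ≤⟨ *-monoˡ-≤ (M ^ 85) (^-monoˡ-≤ 59 64≤M) ⟩
        M ^ 59 * M ^ 85      ≡⟨ ^-distribˡ-+-* M 59 85 ⟨
        M ^ 144              ∎

    diffBound : ∀ N → M ≤ N → ∀ x → x ≤ 1 + 2 * s → ExpLe (x * x) (N ^ (144 * N))
    diffBound N M≤N x x≤1+2s = ExpLe-mono (x * x) a₀ (expBound a₀) (N ^ (144 * N)) (*-mono-≤ x≤2rt x≤2rt)
      (begin
        expBound a₀         ≤⟨ expBound-mono [2rt]²≤a₁ ⟩
        expBound a₁         ≤⟨ expBound-a₁≤M^144M ⟩
        M ^ (144 * M)       ≤⟨ ^-monoˡ-≤ (144 * M) M≤N ⟩
        N ^ (144 * M)       ≤⟨ ^-monoʳ-≤ N {{ℕ.>-nonZero (≤-trans 1≤M M≤N)}} (*-monoʳ-≤ 144 M≤N) ⟩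
        N ^ (144 * N)       ∎)
      (ExpLe-5^ a₀)
      where
      a₀ = 2 * (r * t) * (2 * (r * t))
      x≤2rt : x ≤ 2 * (r * t)
      x≤2rt = ≤-trans x≤1+2s (≤-trans (n≤1+n (1 + 2 * s)) (≤-reflexive (trans (ring s) (cong (2 *_) 1+s≡rt))))
        where
        ring : ∀ s → suc (1 + 2 * s) ≡ 2 * suc s
        ring = solve-∀

module Counting where

  open import Data.Nat
  open import Data.Nat.Properties
  open import Data.Nat.Tactic.RingSolver using (solve-∀)
  open import Data.Bool using (Bool; true; false; if_then_else_; not)
  open import Data.List using (List; []; _∷_; map; length)
  open import Data.List.Properties using (length-map)
  open import Data.Product using (Σ; _×_; _,_)
  open import Data.Sum using (_⊎_; inj₁; inj₂)
  open import Relation.Nullary using (yes; no)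
  open import Relation.Binary.PropositionalEquality
  open import Defs using (countUpTo)
  open Autocorrelation using (agreesAt; disagreesAt; agreements; disagreements; Balanced)

  𝟙ᵇ : Bool → ℕ
  𝟙ᵇ b = if b then 1 else 0

  countUpTo-mono-≤ : ∀ g {x y} → x ≤ y → countUpTo g x ≤ countUpTo g y
  countUpTo-mono-≤ g {x} x≤y with m≤n⇒∃[o]m+o≡n x≤y
  ... | k , refl = go k
    where
    go : ∀ k → countUpTo g x ≤ countUpTo g (x + k)
    go zero    = ≤-reflexive (cong (countUpTo g) (sym (+-identityʳ x)))
    go (suc k) = subst (λ z → countUpTo g x ≤ countUpTo g z) (sym (+-suc x k)) (≤-trans (go k) (m≤m+n _ _))

  countUpTo-transfer : ∀ (g h : ℕ → Bool) (f : ℕ → ℕ) → (∀ b → g b ≡ true → h (f b) ≡ true) →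
                       (∀ b → f b < f (suc b)) → ∀ K → countUpTo g K ≤ countUpTo h (f K)
  countUpTo-transfer g h f g⇒h f-increasing zero with g 0 in g0≡
  ... | true  = ≤-trans (≤-reflexive (cong 𝟙ᵇ (sym (g⇒h 0 g0≡)))) (last h (f 0))
    where
    last : ∀ h y → 𝟙ᵇ (h y) ≤ countUpTo h y
    last h zero    = ≤-refl
    last h (suc y) = m≤n+m _ _
  ... | false = z≤n
  countUpTo-transfer g h f g⇒h f-increasing (suc K) =
    ≤-trans (+-mono-≤ (countUpTo-transfer g h f g⇒h f-increasing K) (step (g (suc K)) refl)) (append (f-increasing K))
    where
    step : ∀ x → g (suc K) ≡ x → 𝟙ᵇ x ≤ 𝟙ᵇ (h (f (suc K)))
    step true  gK≡ = ≤-reflexive (cong 𝟙ᵇ (sym (g⇒h (suc K) gK≡)))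
    step false _   = z≤n
    append : ∀ {x y} → x < y → countUpTo h x + 𝟙ᵇ (h y) ≤ countUpTo h y
    append {x} {suc y} (s≤s x≤y) = +-monoˡ-≤ (𝟙ᵇ (h (suc y))) (countUpTo-mono-≤ h x≤y)

  countUpTo+countUpTo-not : ∀ g K → countUpTo g K + countUpTo (λ b → not (g b)) K ≡ suc K
  countUpTo+countUpTo-not g zero with g 0
  ... | true  = refl
  ... | false = refl
  countUpTo+countUpTo-not g (suc K) =
    trans (regroup (countUpTo g K) (countUpTo (λ b → not (g b)) K) (g (suc K))) (cong suc (countUpTo+countUpTo-not g K))
    where
    regroup : ∀ a c x → a + 𝟙ᵇ x + (c + 𝟙ᵇ (not x)) ≡ suc (a + c)
    regroup a c true  = ring a c
      where
      ring : ∀ a c → a + 1 + (c + 0) ≡ suc (a + c)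
      ring = solve-∀
    regroup a c false = ring a c
      where
      ring : ∀ a c → a + 0 + (c + 1) ≡ suc (a + c)
      ring = solve-∀

  countUpTo-cong : ∀ g g′ K → (∀ b → b ≤ K → g b ≡ g′ b) → countUpTo g K ≡ countUpTo g′ K
  countUpTo-cong g g′ zero    g≡g′ rewrite g≡g′ 0 z≤n = refl
  countUpTo-cong g g′ (suc K) g≡g′ rewrite g≡g′ (suc K) ≤-refl =
    cong (_+ 𝟙ᵇ (g′ (suc K))) (countUpTo-cong g g′ K (λ b b≤K → g≡g′ b (m≤n⇒m≤1+n b≤K)))

  signAt : List Bool → ℕ → Bool
  signAt []       b       = false
  signAt (x ∷ xs) zero    = x
  signAt (x ∷ xs) (suc b) = signAt xs b

  signAt-true⇒< : ∀ ε b → signAt ε b ≡ true → b < length ε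
  signAt-true⇒< (x ∷ xs) zero    _ = s≤s z≤n
  signAt-true⇒< (x ∷ xs) (suc b) h = s≤s (signAt-true⇒< xs b h)

  signAt-map-not : ∀ ε b → b < length ε → signAt (map not ε) b ≡ not (signAt ε b)
  signAt-map-not (x ∷ xs) zero    _         = refl
  signAt-map-not (x ∷ xs) (suc b) (s≤s b<n) = signAt-map-not xs b b<n

  agreesAt-not : ∀ b bs i → agreesAt (not b) (map not bs) i ≡ agreesAt b bs i
  agreesAt-not b     []           i       = refl
  agreesAt-not true  (true  ∷ xs) zero    = refl
  agreesAt-not true  (false ∷ xs) zero    = refl
  agreesAt-not false (true  ∷ xs) zero    = refl
  agreesAt-not false (false ∷ xs) zero    = refl
  agreesAt-not b     (x ∷ xs)     (suc i) = agreesAt-not b xs i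

  disagreesAt-not : ∀ b bs i → disagreesAt (not b) (map not bs) i ≡ disagreesAt b bs i
  disagreesAt-not b     []           i       = refl
  disagreesAt-not true  (true  ∷ xs) zero    = refl
  disagreesAt-not true  (false ∷ xs) zero    = refl
  disagreesAt-not false (true  ∷ xs) zero    = refl
  disagreesAt-not false (false ∷ xs) zero    = refl
  disagreesAt-not b     (x ∷ xs)     (suc i) = disagreesAt-not b xs i

  agreements-not : ∀ ε j → agreements (map not ε) j ≡ agreements ε j
  agreements-not []       j             = refl
  agreements-not (b ∷ bs) zero          = refl
  agreements-not (b ∷ bs) (suc zero)    = agreesAt-not b bs 0
  agreements-not (b ∷ bs) (suc (suc j)) = cong₂ _+_ (agreements-not bs j) (agreesAt-not b bs (suc j))

  disagreements-not : ∀ ε j → disagreements (map not ε) j ≡ disagreements ε j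
  disagreements-not []       j             = refl
  disagreements-not (b ∷ bs) zero          = refl
  disagreements-not (b ∷ bs) (suc zero)    = disagreesAt-not b bs 0
  disagreements-not (b ∷ bs) (suc (suc j)) = cong₂ _+_ (disagreements-not bs j) (disagreesAt-not b bs (suc j))

  Balanced-map-not : ∀ s ε → Balanced s ε → Balanced s (map not ε)
  Balanced-map-not s ε balanced j
    rewrite agreements-not ε j | disagreements-not ε j = balanced j

  -- If fewer than half of the first K + 1 signs are positive, flip them all.
  balanced-majority : ∀ s M K → K < M → Σ (List Bool) (λ ε → length ε ≡ M × Balanced s ε) →
                      Σ (List Bool) (λ ε → length ε ≡ M × Balanced s ε × suc K ≤ 2 * countUpTo (signAt ε) K)
  balanced-majority s M K K<M (ε , len , balanced) with suc K ≤? 2 * countUpTo (signAt ε) K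
  ... | yes majority = ε , len , balanced , majority
  ... | no  minority = map not ε , trans (length-map not ε) len , Balanced-map-not s ε balanced , flipped-majority
    where
    c  = countUpTo (signAt ε) K
    c′ = countUpTo (λ b → not (signAt ε b)) K
    flipped-majority : suc K ≤ 2 * countUpTo (signAt (map not ε)) K
    flipped-majority rewrite countUpTo-cong _ _ K (λ b b≤K → signAt-map-not ε b (subst (b <_) (sym len) (≤-<-trans b≤K K<M)))
      = +-cancelˡ-≤ (2 * c) _ _ (begin
        2 * c + suc K       ≤⟨ +-monoˡ-≤ (suc K) (<⇒≤ (≰⇒> minority)) ⟩
        suc K + suc K       ≡⟨ cong (λ z → z + z) (countUpTo+countUpTo-not (signAt ε) K) ⟨
        (c + c′) + (c + c′) ≡⟨ ring c c′ ⟩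
        2 * c + 2 * c′      ∎)
      where
      open ≤-Reasoning
      ring : ∀ c c′ → (c + c′) + (c + c′) ≡ 2 * c + 2 * c′
      ring = solve-∀

module LinearCombination where

  open import Data.Nat as ℕ using (ℕ; zero; suc; _∸_; z≤n; s≤s; _+_; _*_; _^_; _≤_; _<_; _≤ᵇ_)
  open import Data.Nat.Properties
  open import Data.Nat.Tactic.RingSolver using (solve-∀)
  open import Data.Integer as ℤ using (ℤ; ∣_∣; 0ℤ; 1ℤ)
  import Data.Integer.Properties as ℤ
  open import Data.Fin as Fin using (Fin; toℕ)
  open import Data.Fin.Properties using (toℕ≤pred[n])
  open import Data.Bool using (Bool; true; false; if_then_else_; not)
  open import Data.Bool.Properties using (T-≡)
  open import Data.List using (List; _∷_; length)
  open import Data.Product using (Σ; _×_; _,_)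
  open import Data.Empty using (⊥-elim)
  open import Function using (_∘_)
  open import Function.Bundles using (Equivalence)
  open import Relation.Nullary.Decidable using (yes; no; ⌊_⌋)
  open import Relation.Binary.Definitions using (tri<; tri≈; tri>)
  open import Relation.Binary.PropositionalEquality
  open import Defs using (countUpTo; sumℤ; sumℕ; chiShift; B)
  open Counting

  sumℤ-zero : ∀ {k} (f : Fin k → ℤ) → (∀ i → f i ≡ 0ℤ) → sumℤ f ≡ 0ℤ
  sumℤ-zero {zero}  f f≡0 = refl
  sumℤ-zero {suc k} f f≡0 = cong₂ ℤ._+_ (f≡0 Fin.zero) (sumℤ-zero (λ i → f (Fin.suc i)) (λ i → f≡0 (Fin.suc i)))

  sumℤ-single : ∀ {k} (f : Fin k → ℤ) (j : Fin k) → (∀ i → toℕ i ≢ toℕ j → f i ≡ 0ℤ) → sumℤ f ≡ f j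
  sumℤ-single {suc k} f Fin.zero    f≡0 =
    trans (cong (λ z → f Fin.zero ℤ.+ z) (sumℤ-zero (λ i → f (Fin.suc i)) (λ i → f≡0 (Fin.suc i) (λ ())))) (ℤ.+-identityʳ _)
  sumℤ-single {suc k} f (Fin.suc j) f≡0 =
    trans (cong₂ ℤ._+_ (f≡0 Fin.zero (λ ()))
                       (sumℤ-single (λ i → f (Fin.suc i)) j (λ i i≢j → f≡0 (Fin.suc i) (i≢j ∘ suc-injective))))
          (ℤ.+-identityˡ _)

  firstNonzero : ∀ {k} (f : Fin k → ℤ) → 0 < sumℕ (λ i → ∣ f i ∣) →
                 Σ (Fin k) (λ j → f j ≢ 0ℤ × (∀ i → toℕ i < toℕ j → f i ≡ 0ℤ))
  firstNonzero {suc k} f 0<Σ with f Fin.zero ℤ.≟ 0ℤ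
  ... | no  f0≢0 = Fin.zero , f0≢0 , (λ i ())
  ... | yes f0≡0 with firstNonzero (λ i → f (Fin.suc i)) (subst (λ z → 0 < z ℕ.+ sumℕ (λ i → ∣ f (Fin.suc i) ∣)) (cong ∣_∣ f0≡0) 0<Σ)
  ...   | j , fj≢0 , below-j = Fin.suc j , fj≢0 , below-1+j
    where
    below-1+j : ∀ i → toℕ i < toℕ (Fin.suc j) → f i ≡ 0ℤ
    below-1+j Fin.zero    _         = f0≡0
    below-1+j (Fin.suc i) (s≤s i<j) = below-j i i<j

  -- In a positive block only the last position d belongs to C, so at m = b(d+1) + d + j₀ the
  -- sum Σ λ_i χ_C(m − i) reduces to λ_j₀.
  module _ (d : ℕ) (lam : Fin (suc d) → ℤ) (j₀ : Fin (suc d)) (lam-j₀≢0 : lam j₀ ≢ 0ℤ)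
           (lam-<j₀ : ∀ i → toℕ i < toℕ j₀ → lam i ≡ 0ℤ) where

    open Construction d

    private
      j = toℕ j₀

    nonzeroAt : (ℕ → Bool) → ℕ → Bool
    nonzeroAt C m = not ⌊ sumℤ (λ i → lam i ℤ.* chiShift C m (toℕ i)) ℤ.≟ ℤ.+ 0 ⌋

    blockSet-at : ∀ ε b a → a < p → b < length ε → blockSet ε (b * p + a) ≡ block (signAt ε b) a
    blockSet-at (e ∷ es) zero    a a<p _ with a ℕ.<? p
    ... | yes _   = refl
    ... | no  a≮p = ⊥-elim (a≮p a<p)
    blockSet-at (e ∷ es) (suc b) a a<p (s≤s b<n) with p + b * p + a ℕ.<? p
    ... | yes m<p = ⊥-elim (<⇒≱ m<p (≤-trans (m≤m+n p (b * p)) (m≤m+n _ a)))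
    ... | no  _   = trans (cong (blockSet es) (trans (cong (_∸ p) (+-assoc p (b * p) a)) (m+n∸m≡n p (b * p + a))))
                          (blockSet-at es b a a<p b<n)

    chiShift-≤ : ∀ C m i → i ≤ m → chiShift C m i ≡ (if C (m ∸ i) then 1ℤ else 0ℤ)
    chiShift-≤ C m i i≤m rewrite Equivalence.to T-≡ (≤⇒≤ᵇ i≤m) = refl

    last≡ᵇ : ∀ d → (d ℕ.≡ᵇ d) ≡ true
    last≡ᵇ zero    = refl
    last≡ᵇ (suc d) = last≡ᵇ d

    <last≡ᵇ : ∀ d a → a < d → (d ℕ.≡ᵇ a) ≡ false
    <last≡ᵇ (suc d) zero    _         = refl
    <last≡ᵇ (suc d) (suc a) (s≤s a<d) = <last≡ᵇ d a a<d

    nonzeroAt-positive-block : ∀ ε b → signAt ε b ≡ true → nonzeroAt (blockSet ε) (b * p + (d + j)) ≡ true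
    nonzeroAt-positive-block ε b εb≡true
      with sumℤ (λ i → lam i ℤ.* chiShift (blockSet ε) (b * p + (d + j)) (toℕ i)) ℤ.≟ ℤ.+ 0
    ... | no  _    = refl
    ... | yes Σ≡0  = ⊥-elim (lam-j₀≢0 (trans (sym (ℤ.*-identityʳ (lam j₀))) (trans (sym f-j₀) (trans (sym (sumℤ-single f j₀ others)) Σ≡0))))
      where
      m = b * p + (d + j)
      f : Fin (suc d) → ℤ
      f i = lam i ℤ.* chiShift (blockSet ε) m (toℕ i)
      χ-at : ∀ i → toℕ i ≤ d + j → d + j ∸ toℕ i < p → chiShift (blockSet ε) m (toℕ i) ≡ (if d ℕ.≡ᵇ (d + j ∸ toℕ i) then 1ℤ else 0ℤ)
      χ-at i i≤d+j d+j-i<p = trans (chiShift-≤ (blockSet ε) m (toℕ i) (≤-trans i≤d+j (m≤n+m (d + j) (b * p))))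
        (cong (λ z → if z then 1ℤ else 0ℤ)
          (trans (cong (blockSet ε) (+-∸-assoc (b * p) i≤d+j))
                 (trans (blockSet-at ε b (d + j ∸ toℕ i) d+j-i<p (signAt-true⇒< ε b εb≡true))
                        (cong (λ z → block z (d + j ∸ toℕ i)) εb≡true))))
      f-j₀ : f j₀ ≡ lam j₀ ℤ.* 1ℤ
      f-j₀ = cong (lam j₀ ℤ.*_) (trans (χ-at j₀ (m≤n+m j d) (subst (_< p) (sym (m+n∸n≡m d j)) ≤-refl))
                                  (trans (cong (λ z → if d ℕ.≡ᵇ z then 1ℤ else 0ℤ) (m+n∸n≡m d j))
                                         (cong (λ z → if z then 1ℤ else 0ℤ) (last≡ᵇ d))))
      others : ∀ i → toℕ i ≢ j → f i ≡ 0ℤ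
      others i i≢j with <-cmp (toℕ i) j
      ... | tri< i<j _ _ = trans (cong (ℤ._* chiShift (blockSet ε) m (toℕ i)) (lam-<j₀ i i<j)) (ℤ.*-zeroˡ (chiShift (blockSet ε) m (toℕ i)))
      ... | tri≈ _ i≡j _ = ⊥-elim (i≢j i≡j)
      ... | tri> _ _ j<i = trans (cong (lam i ℤ.*_) (trans (χ-at i i≤d+j (≤-trans a<d (n≤1+n d)))
                                                           (cong (λ z → if z then 1ℤ else 0ℤ) (<last≡ᵇ d a a<d))))
                                 (ℤ.*-zeroʳ (lam i))
        where
        i≤d+j : toℕ i ≤ d + j
        i≤d+j = ≤-trans (toℕ≤pred[n] i) (m≤m+n d j)
        a = d + j ∸ toℕ i
        a<d : a < d
        a<d = +-cancelʳ-≤ j (suc a) d (≤-trans (≤-reflexive (sym (+-suc a j)))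
                (≤-trans (+-monoʳ-≤ a j<i) (≤-reflexive (m∸n+n≡m i≤d+j))))

    B-lower-bound : ∀ ε K → length ε ≡ suc (suc K) → suc K ≤ 2 * countUpTo (signAt ε) K →
                    suc (suc K) ≤ B (blockSet ε) lam (suc (suc K) * p ∸ 1) * 2 ^ (d + 2)
    B-lower-bound ε K len majority = begin
      suc (suc K)              ≤⟨ s≤s (m≤n+m (suc K) K) ⟩
      suc (K + suc K)          ≡⟨ ring₁ K ⟩
      2 * suc K                ≤⟨ *-monoʳ-≤ 2 majority ⟩
      2 * (2 * c)              ≡⟨ ring₂ c ⟩
      c * 4                    ≤⟨ *-mono-≤ c≤B (^-monoʳ-≤ 2 (m≤n+m 2 d)) ⟩
      B (blockSet ε) lam (suc (suc K) * p ∸ 1) * 2 ^ (d + 2) ∎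
      where
      open ≤-Reasoning
      c = countUpTo (signAt ε) K
      witness : ℕ → ℕ
      witness b = b * p + (d + j)
      ring₃ : ∀ K d → K * suc d + (d + suc d) ≡ d + (suc d + K * suc d)
      ring₃ = solve-∀
      last-witness≤ : witness K ≤ suc (suc K) * p ∸ 1
      last-witness≤ = ≤-trans (+-monoʳ-≤ (K * p) (+-monoʳ-≤ d (≤-trans (toℕ≤pred[n] j₀) (n≤1+n d))))
                              (≤-reflexive (ring₃ K d))
      c≤B : c ≤ B (blockSet ε) lam (suc (suc K) * p ∸ 1)
      c≤B = ≤-trans (countUpTo-transfer (signAt ε) (nonzeroAt (blockSet ε)) witness (nonzeroAt-positive-block ε)
                                        (λ b → +-monoˡ-< (d + j) (+-monoˡ-≤ (b * p) (s≤s (z≤n {d})))) K)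
                    (countUpTo-mono-≤ (nonzeroAt (blockSet ε)) last-witness≤)
      ring₁ : ∀ x → suc (x + suc x) ≡ 2 * suc x
      ring₁ = solve-∀
      ring₂ : ∀ c → 2 * (2 * c) ≡ c * 4
      ring₂ = solve-∀

open import Defs
open import Data.Nat using (ℕ; zero; suc; _+_; _*_; _∸_; _^_; _≤_; _<_; s≤s)
open import Data.Nat.Properties using (m≤m*n; n≤1+n)
open import Data.Integer using (ℤ; ∣_∣; _⊖_)
open import Data.Fin using (Fin)
open import Data.Bool using (Bool; true)
open import Data.Product using (Σ; ∃-syntax; _×_; _,_)
open import Relation.Binary.PropositionalEquality using (_≡_; subst)

lemma1 : (d : ℕ) (lam : Fin (suc d) → ℤ) → 0 < sumℕ (λ i → ∣ lam i ∣) →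
    ∃[ M₀ ] ((M : ℕ) → M₀ ≤ M → 0 < M →
      Σ (ℕ → Bool) (λ C →
        ((m : ℕ) → C m ≡ true → m < M * suc d)
        × ((n : ℕ) → DiffBound (R C n ⊖ Rprev C n) (M * suc d))
        × (M ≤ B C lam (M * suc d ∸ 1) * 2 ^ (d + 2))))
lemma1 d lam 0<Σ∣lam∣ with LinearCombination.firstNonzero lam 0<Σ∣lam∣
... | j₀ , lam-j₀≢0 , lam-<j₀ = 64 , construction
  where
  open Construction d
  open Autocorrelation using (∣autocorrelation∣≤)
  open Counting using (balanced-majority)
  open LinearCombination using (B-lower-bound)

  construction : (M : ℕ) → 64 ≤ M → 0 < M →
    Σ (ℕ → Bool) (λ C →
      ((m : ℕ) → C m ≡ true → m < M * suc d)
      × ((n : ℕ) → DiffBound (R C n ⊖ Rprev C n) (M * suc d))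
      × (M ≤ B C lam (M * suc d ∸ 1) * 2 ^ (d + 2)))
  construction (suc zero) (s≤s ())
  construction (suc (suc K)) 64≤M 0<M =
    let ε , len , balanced , majority = balanced-majority s M K (n≤1+n (suc K))
                                          (Chernoff.balanced-exists (suc r) r s M (n≤1+n r) 0<M tail-small)
    in blockSet ε
     , (λ m m∈C → subst (λ l → m < l * suc d) len (blockSet-< ε m m∈C))
     , (λ n → diffBound (M * suc d) (m≤m*n M (suc d)) _ (ΔR-bound ε (1 + 2 * s) (∣autocorrelation∣≤ s ε balanced) n))
     , B-lower-bound d lam j₀ lam-j₀≢0 lam-<j₀ ε K len majority
    where
    M = suc (suc K)
    open Parameters.Choice M 64≤M using (r; s; tail-small; diffBound)
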